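{- Let $P_n(x),Q_n(x)$ be the canonical numerator and denominator polynomials of the $n$-th convergent of the Thue–Morse continued fraction (defined in the context). Then, modulo 4 (coefficientwise): 1) $P_{2^{2m}-1}(x)\equiv 1+2S^o_{m-1}(x)$ for $m\ge1$; 2) $P_{2^{2m+1}-1}(x)\equiv 1+2x(1-\delta_{m,0})+2S^e_m(x)$ for $m\ge0$; 3) $P_{2^{2m}-2}(x)\equiv 1+x^{ -1}S_{2m-1}(x)^2-2S^e_m(x)$ for $m\ge1$; 4) $P_{2^{2m+1}-2}(x)\equiv 1+x^{ -1}S_{2m}(x)^2-2S^o_m(x)$ for $m\ge0$; 5) $Q_{2^{2m}-1}(x)\equiv 1-x+2x^{2^{2m-1}}-S_{2m-1}(x)^2+2xS^e_m(x)$ for $m\ge1$; 6) $Q_{2^{2m+1}-1}(x)\equiv 1-x+2x^{2^{2m}}(1-\delta_{m,0})-S_{2m}(x)^2+2xS^o_m(x)$ for $m\ge0$; 7) $Q_{2^{2m}-2}(x)\equiv 1+2S_{2m-1}(x)$ for $m\ge1$; 8) $Q_{2^{2m+1}-2}(x)\equiv 1+2x(1-\delta_{m,0})+2S_{2m}(x)$ for $m\ge0$.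
   Context: Thue–Morse sequence: $t_0=1$, $t_{2n}=t_n$ ($n\ge1$), $t_{2n+1}=-t_n$. With $a_n=t_n$, set $P_0=a_0$, $Q_0=1$, $P_1=a_0$, $Q_1=1+a_1x$ and for $n\ge2$ $$\begin{pmatrix}1&a_nx\\1&0\end{pmatrix}\cdots\begin{pmatrix}1&a_2x\\1&0\end{pmatrix}\begin{pmatrix}P_1&Q_1\\P_0&Q_0\end{pmatrix}=\begin{pmatrix}P_n&Q_n\\P_{n-1}&Q_{n-1}\end{pmatrix}.$$ For $m\ge0$: $S_m(x)=\sum_{j=0}^{m-1}x^{2^j}$, $S^e_m(x)=\sum_{j=0}^{m-1}x^{2^{2j}}$, $S^o_m(x)=\sum_{j=0}^{m-1}x^{2^{2j+1}}$ (empty sums are $0$). $\delta_{i,j}$ is the Kronecker delta. Expressions with $x^{ -1}$ are polynomials in $x$ since $S_k(x)^2$ is divisible by $x$ (or is $0$). -}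

module Defs where

open import Data.Nat as ℕ using (ℕ; zero; suc; _∸_; _^_)
open import Data.Nat.Base using (⌊_/2⌋)
open import Data.Bool using (Bool; true; false; if_then_else_)
open import Data.Integer as ℤ using (ℤ; +_; -_; _-_)
open import Data.Integer.Divisibility using (_∣_)
open import Data.List using (List; []; _∷_; map; replicate; _++_; tail)
open import Data.Maybe using (Maybe; just; nothing)

-- Polynomials with integer coefficients: coefficient lists, lowest degree first.

Poly : Set
Poly = List ℤ

coeff : Poly → ℕ → ℤ
coeff []      _       = + 0
coeff (a ∷ p) zero    = a
coeff (a ∷ p) (suc k) = coeff p k

infixl 6 _⊕_ _⊖_
infixl 7 _⊗_ _·_

_⊕_ : Poly → Poly → Poly
[]      ⊕ q       = q
(a ∷ p) ⊕ []      = a ∷ p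
(a ∷ p) ⊕ (b ∷ q) = (a ℤ.+ b) ∷ (p ⊕ q)

_·_ : ℤ → Poly → Poly
c · p = map (c ℤ.*_) p

mulX : Poly → Poly
mulX p = + 0 ∷ p

_⊖_ : Poly → Poly → Poly
p ⊖ q = p ⊕ ((- + 1) · q)

_⊗_ : Poly → Poly → Poly
[]      ⊗ q = []
(a ∷ p) ⊗ q = (a · q) ⊕ mulX (p ⊗ q)

const : ℤ → Poly
const c = c ∷ []

X : Poly
X = + 0 ∷ + 1 ∷ []

mono : ℕ → Poly
mono k = replicate k (+ 0) ++ (+ 1 ∷ [])

-- division by x (drop the constant coefficient); exact when the
-- constant coefficient is 0
divX : Poly → Poly
divX p = tail' p
  where
  tail' : Poly → Poly
  tail' []      = []
  tail' (_ ∷ q) = q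

_≡₄_ : Poly → Poly → Set
p ≡₄ q = ∀ k → (+ 4) ∣ (coeff p k - coeff q k)

-- Thue–Morse sequence: t 0 = 1, t (2n) = t n (n ≥ 1), t (2n+1) = - t n.

even? : ℕ → Bool
even? zero          = true
even? (suc zero)    = false
even? (suc (suc n)) = even? n

-- fuel-based recursion on the binary expansion; fuel n suffices for n
tmAux : ℕ → ℕ → ℤ
tmAux zero    _       = + 1
tmAux (suc f) zero    = + 1
tmAux (suc f) (suc n) =
  if even? (suc n) then tmAux f ⌊ suc n /2⌋ else - tmAux f ⌊ suc n /2⌋

t : ℕ → ℤ
t n = tmAux n n

a : ℕ → ℤ
a = t

-- Convergent numerators / denominators.
-- The matrix recursion is equivalent to
--   P n = P (n-1) + a n · x · P (n-2),  Q n = Q (n-1) + a n · x · Q (n-2)  (n ≥ 2).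

P : ℕ → Poly
P zero                = const (a 0)
P (suc zero)          = const (a 0)
P (suc (suc n))       = P (suc n) ⊕ mulX (a (suc (suc n)) · P n)

Q : ℕ → Poly
Q zero                = const (+ 1)
Q (suc zero)          = const (+ 1) ⊕ mulX (const (a 1))
Q (suc (suc n))       = Q (suc n) ⊕ mulX (a (suc (suc n)) · Q n)

S : ℕ → Poly
S zero    = []
S (suc m) = S m ⊕ mono (2 ^ m)

Se : ℕ → Poly
Se zero    = []
Se (suc m) = Se m ⊕ mono (2 ^ (2 ℕ.* m))

So : ℕ → Poly
So zero    = []
So (suc m) = So m ⊕ mono (2 ^ (2 ℕ.* m ℕ.+ 1))

δ0 : ℕ → ℤ
δ0 zero    = + 1
δ0 (suc _) = + 0

-- Let C n be the matrix with rows (P (n + 1), Q (n + 1)) and (P n, Q n). The recursion makes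
-- C n a product of the matrices [[1, t_i x], [1, 0]], i ≤ n + 1, times a constant matrix.
-- Because t (L + i) = − t i for L = 2^k and i < L, the factors with indices in [L, 2L) are
-- the first L factors with x replaced by −x; this gives the doubling relation
-- C (2L − 2) = σ(C (L − 2)) · [[0, −x], [1, 0]] · C (L − 2), where σ p = p(−x).
-- Multiplying the second row by x removes the division by x hidden in P. Modulo 4 the matrix
-- at index 2^(k+1) − 2 is then an explicit polynomial ansatz in x, y = x^(2^k) and the two
-- halves u, v of S_k (the exponents 2^j with j ≡ k, resp. j ≢ k, mod 2). Since
-- S_k² = S_(k+1) − x + 2·(cross terms), y is a polynomial in u, v, x and the cross terms, and
-- the doubling relation carries the ansatz at level k to the ansatz at level k + 1 by a
-- polynomial identity over ℤ/4ℤ, which the ring solver checks. Induction on k then yields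
-- all eight congruences.
module Submission where

open import Algebra.Bundles.Raw using (RawRing)
import Algebra.Solver.Ring as RingSolver
open import Algebra.Solver.Ring.AlmostCommutativeRing
  using (AlmostCommutativeRing; _-Raw-AlmostCommutative⟶_)
open import Data.Bool using (Bool; true; false; if_then_else_; not)
open import Data.Fin using (#_)
open import Data.Integer as ℤ using (ℤ; +_)
open import Data.Integer.Divisibility.Signed
  using (_∣_; _∣?_; divides; ∣m∣n⇒∣m+n; ∣m⇒∣-m; ∣n⇒∣m*n; ∣⇒∣ᵤ)
import Data.Integer.Properties as ℤ
open import Data.Integer.Solver using (module +-*-Solver)
open import Data.List using ([]; _∷_)
open import Data.Maybe using (Maybe; just; nothing)
open import Data.Nat as ℕ using (ℕ; zero; suc; NonZero; z≤n; s≤s)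
import Data.Nat.DivMod as ℕ
import Data.Nat.Properties as ℕ
open import Data.Product using (_×_; _,_; uncurry)
open import Data.Vec as Vec using (Vec; []; _∷_)
import Data.Vec.Properties as Vec
open import Data.Vec.Relation.Binary.Pointwise.Inductive as Pointwise using (Pointwise; []; _∷_)
open import Level using (0ℓ)
open import Relation.Binary.Bundles using (Setoid)
open import Relation.Binary.Definitions using (Decidable)
open import Relation.Binary.PropositionalEquality
  using (_≡_; refl; sym; trans; cong; cong₂; subst; subst₂; module ≡-Reasoning)
import Relation.Binary.Reasoning.Setoid
import Relation.Binary.Reflection
open import Relation.Nullary using (Dec; yes; no)
open import Relation.Nullary.Decidable using (True; map′; _×-dec_; from-yes; toWitness)

open import Defs

-- The Thue–Morse sequence

module ThueMorse where

  open import Data.Empty using (⊥-elim)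
  open import Data.Integer using (-_)
  open import Data.Nat using (_+_; _^_; _≤_; _<_; _<?_; ⌊_/2⌋)
  open import Data.Nat.Solver using () renaming (module +-*-Solver to ℕ-Solver)

  tmAux-fuel : ∀ {f g} n → n ≤ f → n ≤ g → tmAux f n ≡ tmAux g n
  tmAux-fuel {zero}  {zero}  zero    _       _       = refl
  tmAux-fuel {zero}  {suc g} zero    _       _       = refl
  tmAux-fuel {suc f} {zero}  zero    _       _       = refl
  tmAux-fuel {suc f} {suc g} zero    _       _       = refl
  tmAux-fuel {suc f} {suc g} (suc n) (s≤s p) (s≤s q) =
    cong (λ z → if even? (suc n) then z else - z) (tmAux-fuel ⌊ suc n /2⌋ (half≤ p) (half≤ q))
    where half≤ : ∀ {m} → n ≤ m → ⌊ suc n /2⌋ ≤ m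
          half≤ = ℕ.≤-trans (ℕ.≤-pred (ℕ.⌊n/2⌋<n n))

  t-suc : ∀ n → t (suc n) ≡ (if even? (suc n) then t ⌊ suc n /2⌋ else - t ⌊ suc n /2⌋)
  t-suc n = cong (λ z → if even? (suc n) then z else - z)
    (tmAux-fuel ⌊ suc n /2⌋ (ℕ.≤-pred (ℕ.⌊n/2⌋<n n)) ℕ.≤-refl)

  even?-double : ∀ k → even? (k + k) ≡ true
  even?-double zero    = refl
  even?-double (suc k) rewrite ℕ.+-suc k k = even?-double k

  even?-double+1 : ∀ k → even? (suc (k + k)) ≡ false
  even?-double+1 zero    = refl
  even?-double+1 (suc k) rewrite ℕ.+-suc k k = even?-double+1 k

  ⌊double/2⌋ : ∀ k → ⌊ k + k /2⌋ ≡ k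
  ⌊double/2⌋ zero    = refl
  ⌊double/2⌋ (suc k) rewrite ℕ.+-suc k k = cong suc (⌊double/2⌋ k)

  ⌊double+1/2⌋ : ∀ k → ⌊ suc (k + k) /2⌋ ≡ k
  ⌊double+1/2⌋ zero    = refl
  ⌊double+1/2⌋ (suc k) rewrite ℕ.+-suc k k = cong suc (⌊double+1/2⌋ k)

  t-double : ∀ k → t (k + k) ≡ t k
  t-double zero    = refl
  t-double (suc k) with t-suc (k + suc k)
  ... | eq rewrite even?-double (suc k) | ⌊double/2⌋ (suc k) = eq

  t-double+1 : ∀ k → t (suc (k + k)) ≡ - t k
  t-double+1 k with t-suc (k + k)
  ... | eq rewrite even?-double+1 k | ⌊double+1/2⌋ k = eq

  2^suc : ∀ k → 2 ^ suc k ≡ 2 ^ k + 2 ^ k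
  2^suc k = cong (λ z → 2 ^ k + z) (ℕ.+-identityʳ (2 ^ k))

  2^suc+double : ∀ k j → 2 ^ suc k + (j + j) ≡ (2 ^ k + j) + (2 ^ k + j)
  2^suc+double k j = trans (cong (_+ (j + j)) (2^suc k))
    (solve 2 (λ L j → (L :+ L) :+ (j :+ j) := (L :+ j) :+ (L :+ j)) refl (2 ^ k) j)
    where open ℕ-Solver

  data Parity : ℕ → Set where
    even : ∀ j → Parity (j + j)
    odd  : ∀ j → Parity (suc (j + j))

  parity : ∀ i → Parity i
  parity zero = even 0
  parity (suc i) with parity i
  ... | even j = odd j
  ... | odd j  = subst Parity (ℕ.+-suc (suc j) j) (even (suc j))

  double<double⇒< : ∀ {j L} → j + j < L + L → j < L
  double<double⇒< {j} {L} h with j <? L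
  ... | yes j<L = j<L
  ... | no j≮L  = ⊥-elim (ℕ.<⇒≱ h (ℕ.+-mono-≤ (ℕ.≮⇒≥ j≮L) (ℕ.≮⇒≥ j≮L)))

  t-block : ∀ k i → i < 2 ^ k → t (2 ^ k + i) ≡ - t i
  t-block zero    zero    _        = refl
  t-block zero    (suc i) (s≤s ())
  t-block (suc k) i i<2^suc with parity i
  ... | even j = begin
    t (2 ^ suc k + (j + j))        ≡⟨ cong t (2^suc+double k j) ⟩
    t ((2 ^ k + j) + (2 ^ k + j))  ≡⟨ t-double (2 ^ k + j) ⟩
    t (2 ^ k + j)                  ≡⟨ t-block k j (double<double⇒< (ℕ.<-≤-trans i<2^suc (ℕ.≤-reflexive (2^suc k)))) ⟩
    - t j                          ≡⟨ cong -_ (t-double j) ⟨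
    - t (j + j)                    ∎
    where open ≡-Reasoning
  ... | odd j = begin
    t (2 ^ suc k + suc (j + j))          ≡⟨ cong t (trans (ℕ.+-suc (2 ^ suc k) (j + j)) (cong suc (2^suc+double k j))) ⟩
    t (suc ((2 ^ k + j) + (2 ^ k + j)))  ≡⟨ t-double+1 (2 ^ k + j) ⟩
    - t (2 ^ k + j)                      ≡⟨ cong -_ (t-block k j (double<double⇒< j+j<)) ⟩
    - - t j                              ≡⟨ cong -_ (t-double+1 j) ⟨
    - t (suc (j + j))                    ∎
    where open ≡-Reasoning
          j+j< = ℕ.<-trans (ℕ.n<1+n (j + j)) (ℕ.<-≤-trans i<2^suc (ℕ.≤-reflexive (2^suc k)))

open ThueMorse using (t-block; 2^suc)

neg : Poly → Poly
neg p = ℤ.-1ℤ · p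

coeff-⊕ : ∀ p q k → coeff (p ⊕ q) k ≡ coeff p k ℤ.+ coeff q k
coeff-⊕ []      q       k       = sym (ℤ.+-identityˡ _)
coeff-⊕ (a ∷ p) []      k       = sym (ℤ.+-identityʳ _)
coeff-⊕ (a ∷ p) (b ∷ q) zero    = refl
coeff-⊕ (a ∷ p) (b ∷ q) (suc k) = coeff-⊕ p q k

coeff-· : ∀ c p k → coeff (c · p) k ≡ c ℤ.* coeff p k
coeff-· c []      k       = sym (ℤ.*-zeroʳ c)
coeff-· c (a ∷ p) zero    = refl
coeff-· c (a ∷ p) (suc k) = coeff-· c p k

coeff-neg : ∀ p k → coeff (neg p) k ≡ ℤ.- coeff p k
coeff-neg p k = trans (coeff-· ℤ.-1ℤ p k) (ℤ.-1*i≡-i (coeff p k))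

-- σ p = p(−x)
σ : Poly → Poly
σ []      = []
σ (a ∷ p) = a ∷ neg (σ p)

coeff-σ : ∀ p k → coeff (σ p) k ≡ ℤ.-1ℤ ℤ.^ k ℤ.* coeff p k
coeff-σ []      k       = sym (ℤ.*-zeroʳ (ℤ.-1ℤ ℤ.^ k))
coeff-σ (a ∷ p) zero    = sym (ℤ.*-identityˡ a)
coeff-σ (a ∷ p) (suc k) = begin
  coeff (neg (σ p)) k                      ≡⟨ coeff-neg (σ p) k ⟩
  ℤ.- coeff (σ p) k                        ≡⟨ cong ℤ.-_ (coeff-σ p k) ⟩
  ℤ.- (ℤ.-1ℤ ℤ.^ k ℤ.* coeff p k)          ≡⟨ ℤ.-1*i≡-i (ℤ.-1ℤ ℤ.^ k ℤ.* coeff p k) ⟨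
  ℤ.-1ℤ ℤ.* (ℤ.-1ℤ ℤ.^ k ℤ.* coeff p k)    ≡⟨ ℤ.*-assoc ℤ.-1ℤ (ℤ.-1ℤ ℤ.^ k) (coeff p k) ⟨
  ℤ.-1ℤ ℤ.^ suc k ℤ.* coeff p k            ∎
  where open ≡-Reasoning

module Congruence (n : ℕ) where

  infix 4 _~_ _≋_ _~?_ _≋?_

  -- Records rather than plain definitions, so that the compared values can be inferred.
  record _~_ (a b : ℤ) : Set where
    constructor ~-intro
    field n∣a-b : + n ∣ a ℤ.- b
  open _~_ public

  record _≋_ (p q : Poly) : Set where
    constructor coeffwise
    field coeff-~ : ∀ k → coeff p k ~ coeff q k
  open _≋_ public

  ~-via : ∀ {x a b} → + n ∣ x → x ≡ a ℤ.- b → a ~ b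
  ~-via h eq = ~-intro (subst (+ n ∣_) eq h)

  ~-reflexive : ∀ {a b} → a ≡ b → a ~ b
  ~-reflexive {a} refl = ~-intro (divides (+ 0) (ℤ.+-inverseʳ a))

  ~-sym : ∀ {a b} → a ~ b → b ~ a
  ~-sym {a} {b} (~-intro h) = ~-via (∣m⇒∣-m h) (solve 2 (λ a b → :- (a :- b) := b :- a) refl a b)
    where open +-*-Solver

  ~-trans : ∀ {a b c} → a ~ b → b ~ c → a ~ c
  ~-trans {a} {b} {c} (~-intro h) (~-intro h′) =
    ~-via (∣m∣n⇒∣m+n h h′) (solve 3 (λ a b c → (a :- b) :+ (b :- c) := a :- c) refl a b c)
    where open +-*-Solver

  +-cong : ∀ {a b c d} → a ~ b → c ~ d → a ℤ.+ c ~ b ℤ.+ d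
  +-cong {a} {b} {c} {d} (~-intro h) (~-intro h′) = ~-via (∣m∣n⇒∣m+n h h′)
    (solve 4 (λ a b c d → (a :- b) :+ (c :- d) := (a :+ c) :- (b :+ d)) refl a b c d)
    where open +-*-Solver

  *-congˡ : ∀ c {a b} → a ~ b → c ℤ.* a ~ c ℤ.* b
  *-congˡ c {a} {b} (~-intro h) =
    ~-via (∣n⇒∣m*n c h) (solve 3 (λ c a b → c :* (a :- b) := c :* a :- c :* b) refl c a b)
    where open +-*-Solver

  ~0⇒*~0 : ∀ {a} c → a ~ + 0 → a ℤ.* c ~ + 0
  ~0⇒*~0 {a} c h = subst₂ _~_ (ℤ.*-comm c a) (ℤ.*-zeroʳ c) (*-congˡ c h)

  coeffwise-≡ : ∀ {p q} → (∀ k → coeff p k ≡ coeff q k) → p ≋ q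
  coeffwise-≡ eq = coeffwise λ k → ~-reflexive (eq k)

  ≋-refl : ∀ {p} → p ≋ p
  ≋-refl = coeffwise-≡ λ _ → refl

  ≋-reflexive : ∀ {p q} → p ≡ q → p ≋ q
  ≋-reflexive refl = ≋-refl

  ≋-sym : ∀ {p q} → p ≋ q → q ≋ p
  ≋-sym h = coeffwise λ k → ~-sym (coeff-~ h k)

  ≋-trans : ∀ {p q r} → p ≋ q → q ≋ r → p ≋ r
  ≋-trans h h′ = coeffwise λ k → ~-trans (coeff-~ h k) (coeff-~ h′ k)

  ≋-setoid : Setoid 0ℓ 0ℓ
  ≋-setoid = record
    { Carrier = Poly ; _≈_ = _≋_
    ; isEquivalence = record { refl = ≋-refl ; sym = ≋-sym ; trans = ≋-trans } }

  module ≋-Reasoning = Relation.Binary.Reasoning.Setoid ≋-setoid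

  ∷-cong : ∀ {a b p q} → a ~ b → p ≋ q → a ∷ p ≋ b ∷ q
  ∷-cong h h′ = coeffwise λ { zero → h ; (suc k) → coeff-~ h′ k }

  mulX-cong : ∀ {p q} → p ≋ q → mulX p ≋ mulX q
  mulX-cong = ∷-cong (~-reflexive refl)

  ⊕-cong : ∀ {p p′ q q′} → p ≋ p′ → q ≋ q′ → p ⊕ q ≋ p′ ⊕ q′
  ⊕-cong {p} {p′} {q} {q′} h h′ = coeffwise λ k →
    subst₂ _~_ (sym (coeff-⊕ p q k)) (sym (coeff-⊕ p′ q′ k)) (+-cong (coeff-~ h k) (coeff-~ h′ k))

  ⊕-congˡ : ∀ p {q q′} → q ≋ q′ → p ⊕ q ≋ p ⊕ q′
  ⊕-congˡ p = ⊕-cong (≋-refl {p})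

  ⊕-congʳ : ∀ {p p′} q → p ≋ p′ → p ⊕ q ≋ p′ ⊕ q
  ⊕-congʳ q p≋p′ = ⊕-cong p≋p′ (≋-refl {q})

  ·-congˡ : ∀ c {p q} → p ≋ q → c · p ≋ c · q
  ·-congˡ c {p} {q} h = coeffwise λ k →
    subst₂ _~_ (sym (coeff-· c p k)) (sym (coeff-· c q k)) (*-congˡ c (coeff-~ h k))

  neg-cong : ∀ {p q} → p ≋ q → neg p ≋ neg q
  neg-cong = ·-congˡ ℤ.-1ℤ

  0ₚ 1ₚ : Poly
  0ₚ = const (+ 0)
  1ₚ = const (+ 1)

  []≋0ₚ : [] ≋ 0ₚ
  []≋0ₚ = coeffwise-≡ λ { zero → refl ; (suc k) → refl }

  ⊕-comm : ∀ p q → p ⊕ q ≋ q ⊕ p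
  ⊕-comm p q = coeffwise-≡ λ k → begin
    coeff (p ⊕ q) k          ≡⟨ coeff-⊕ p q k ⟩
    coeff p k ℤ.+ coeff q k  ≡⟨ ℤ.+-comm (coeff p k) (coeff q k) ⟩
    coeff q k ℤ.+ coeff p k  ≡⟨ coeff-⊕ q p k ⟨
    coeff (q ⊕ p) k          ∎
    where open ≡-Reasoning

  ⊕-assoc : ∀ p q r → (p ⊕ q) ⊕ r ≋ p ⊕ (q ⊕ r)
  ⊕-assoc p q r = coeffwise-≡ λ k → begin
    coeff ((p ⊕ q) ⊕ r) k                    ≡⟨ coeff-⊕ (p ⊕ q) r k ⟩
    coeff (p ⊕ q) k ℤ.+ coeff r k            ≡⟨ cong (ℤ._+ coeff r k) (coeff-⊕ p q k) ⟩
    (coeff p k ℤ.+ coeff q k) ℤ.+ coeff r k  ≡⟨ ℤ.+-assoc (coeff p k) (coeff q k) (coeff r k) ⟩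
    coeff p k ℤ.+ (coeff q k ℤ.+ coeff r k)  ≡⟨ cong (λ z → coeff p k ℤ.+ z) (coeff-⊕ q r k) ⟨
    coeff p k ℤ.+ coeff (q ⊕ r) k            ≡⟨ coeff-⊕ p (q ⊕ r) k ⟨
    coeff (p ⊕ (q ⊕ r)) k                    ∎
    where open ≡-Reasoning

  ⊕-identityˡ : ∀ p → 0ₚ ⊕ p ≋ p
  ⊕-identityˡ p = ⊕-congʳ p (≋-sym []≋0ₚ)

  ⊕-identityʳ : ∀ p → p ⊕ 0ₚ ≋ p
  ⊕-identityʳ p = ≋-trans (⊕-comm p 0ₚ) (⊕-identityˡ p)

  ⊕-[] : ∀ p → p ⊕ [] ≋ p
  ⊕-[] p = coeffwise-≡ λ k → trans (coeff-⊕ p [] k) (ℤ.+-identityʳ _)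

  ⊕-interchange : ∀ p q r s → (p ⊕ q) ⊕ (r ⊕ s) ≋ (p ⊕ r) ⊕ (q ⊕ s)
  ⊕-interchange p q r s = begin
    (p ⊕ q) ⊕ (r ⊕ s)  ≈⟨ ⊕-assoc p q (r ⊕ s) ⟩
    p ⊕ (q ⊕ (r ⊕ s))  ≈⟨ ⊕-congˡ p (⊕-assoc q r s) ⟨
    p ⊕ ((q ⊕ r) ⊕ s)  ≈⟨ ⊕-congˡ p (⊕-congʳ s (⊕-comm q r)) ⟩
    p ⊕ ((r ⊕ q) ⊕ s)  ≈⟨ ⊕-congˡ p (⊕-assoc r q s) ⟩
    p ⊕ (r ⊕ (q ⊕ s))  ≈⟨ ⊕-assoc p r (q ⊕ s) ⟨
    (p ⊕ r) ⊕ (q ⊕ s)  ∎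
    where open ≋-Reasoning

  ·-distribˡ : ∀ c p q → c · (p ⊕ q) ≋ c · p ⊕ c · q
  ·-distribˡ c p q = coeffwise-≡ λ k → begin
    coeff (c · (p ⊕ q)) k                       ≡⟨ coeff-· c (p ⊕ q) k ⟩
    c ℤ.* coeff (p ⊕ q) k                       ≡⟨ cong (c ℤ.*_) (coeff-⊕ p q k) ⟩
    c ℤ.* (coeff p k ℤ.+ coeff q k)             ≡⟨ ℤ.*-distribˡ-+ c (coeff p k) (coeff q k) ⟩
    c ℤ.* coeff p k ℤ.+ c ℤ.* coeff q k         ≡⟨ cong₂ ℤ._+_ (coeff-· c p k) (coeff-· c q k) ⟨
    coeff (c · p) k ℤ.+ coeff (c · q) k         ≡⟨ coeff-⊕ (c · p) (c · q) k ⟨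
    coeff (c · p ⊕ c · q) k                     ∎
    where open ≡-Reasoning

  ·-distribʳ : ∀ c d p → (c ℤ.+ d) · p ≋ c · p ⊕ d · p
  ·-distribʳ c d p = coeffwise-≡ λ k → begin
    coeff ((c ℤ.+ d) · p) k                     ≡⟨ coeff-· (c ℤ.+ d) p k ⟩
    (c ℤ.+ d) ℤ.* coeff p k                     ≡⟨ ℤ.*-distribʳ-+ (coeff p k) c d ⟩
    c ℤ.* coeff p k ℤ.+ d ℤ.* coeff p k         ≡⟨ cong₂ ℤ._+_ (coeff-· c p k) (coeff-· d p k) ⟨
    coeff (c · p) k ℤ.+ coeff (d · p) k         ≡⟨ coeff-⊕ (c · p) (d · p) k ⟨
    coeff (c · p ⊕ d · p) k                     ∎
    where open ≡-Reasoning

  ·-assoc : ∀ c d p → c · (d · p) ≋ (c ℤ.* d) · p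
  ·-assoc c d p = coeffwise-≡ λ k → begin
    coeff (c · (d · p)) k    ≡⟨ coeff-· c (d · p) k ⟩
    c ℤ.* coeff (d · p) k    ≡⟨ cong (c ℤ.*_) (coeff-· d p k) ⟩
    c ℤ.* (d ℤ.* coeff p k)  ≡⟨ ℤ.*-assoc c d (coeff p k) ⟨
    (c ℤ.* d) ℤ.* coeff p k  ≡⟨ coeff-· (c ℤ.* d) p k ⟨
    coeff ((c ℤ.* d) · p) k  ∎
    where open ≡-Reasoning

  ·-identity : ∀ p → + 1 · p ≋ p
  ·-identity p = coeffwise-≡ λ k → trans (coeff-· (+ 1) p k) (ℤ.*-identityˡ (coeff p k))

  ·-zero : ∀ p → + 0 · p ≋ []
  ·-zero p = coeffwise-≡ λ k → trans (coeff-· (+ 0) p k) (ℤ.*-zeroˡ (coeff p k))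

  ·-mulX : ∀ c p → c · mulX p ≋ mulX (c · p)
  ·-mulX c p = ∷-cong (~-reflexive (ℤ.*-zeroʳ c)) ≋-refl

  neg-⊕ : ∀ p q → neg p ⊕ neg q ≋ neg (p ⊕ q)
  neg-⊕ p q = ≋-sym (·-distribˡ ℤ.-1ℤ p q)

  neg-involutive : ∀ p → neg (neg p) ≋ p
  neg-involutive p = ≋-trans (·-assoc ℤ.-1ℤ ℤ.-1ℤ p) (·-identity p)

  ≋⇒⊕-neg≋[] : ∀ p q → p ≋ q → p ⊕ neg q ≋ []
  ≋⇒⊕-neg≋[] p q h = coeffwise λ k →
    subst₂ _~_ (sym (trans (coeff-⊕ p (neg q) k) (cong (λ z → coeff p k ℤ.+ z) (coeff-neg q k))))
      (ℤ.+-inverseʳ (coeff q k)) (+-cong (coeff-~ h k) (~-reflexive {a = ℤ.- coeff q k} refl))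

  ⊕-neg≋[]⇒≋ : ∀ p q → p ⊕ neg q ≋ [] → p ≋ q
  ⊕-neg≋[]⇒≋ p q h = coeffwise λ k → ~-via (n∣a-b (coeff-~ h k)) (begin
    coeff (p ⊕ neg q) k ℤ.- + 0      ≡⟨ ℤ.+-identityʳ _ ⟩
    coeff (p ⊕ neg q) k              ≡⟨ coeff-⊕ p (neg q) k ⟩
    coeff p k ℤ.+ coeff (neg q) k    ≡⟨ cong (λ z → coeff p k ℤ.+ z) (coeff-neg q k) ⟩
    coeff p k ℤ.- coeff q k          ∎)
    where open ≡-Reasoning

  mulX-⊗ : ∀ p q → mulX p ⊗ q ≋ mulX (p ⊗ q)
  mulX-⊗ p q = ⊕-congʳ (mulX (p ⊗ q)) (·-zero q)

  ⊗-distribʳ : ∀ p q r → (p ⊕ q) ⊗ r ≋ p ⊗ r ⊕ q ⊗ r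
  ⊗-distribʳ []      q       r = ≋-refl
  ⊗-distribʳ (c ∷ p) []      r = ≋-sym (⊕-[] _)
  ⊗-distribʳ (c ∷ p) (d ∷ q) r = begin
    (c ℤ.+ d) · r ⊕ mulX ((p ⊕ q) ⊗ r)
      ≈⟨ ⊕-cong (·-distribʳ c d r) (mulX-cong (⊗-distribʳ p q r)) ⟩
    (c · r ⊕ d · r) ⊕ (mulX (p ⊗ r) ⊕ mulX (q ⊗ r))
      ≈⟨ ⊕-interchange (c · r) (d · r) (mulX (p ⊗ r)) (mulX (q ⊗ r)) ⟩
    (c · r ⊕ mulX (p ⊗ r)) ⊕ (d · r ⊕ mulX (q ⊗ r))   ∎
    where open ≋-Reasoning

  ·-⊗ : ∀ c p q → (c · p) ⊗ q ≋ c · (p ⊗ q)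
  ·-⊗ c []      q = ≋-refl
  ·-⊗ c (d ∷ p) q = begin
    (c ℤ.* d) · q ⊕ mulX ((c · p) ⊗ q)  ≈⟨ ⊕-cong (≋-sym (·-assoc c d q)) (mulX-cong (·-⊗ c p q)) ⟩
    c · (d · q) ⊕ mulX (c · (p ⊗ q))    ≈⟨ ⊕-congˡ (c · (d · q)) (·-mulX c (p ⊗ q)) ⟨
    c · (d · q) ⊕ c · mulX (p ⊗ q)      ≈⟨ ·-distribˡ c (d · q) (mulX (p ⊗ q)) ⟨
    c · (d · q ⊕ mulX (p ⊗ q))          ∎
    where open ≋-Reasoning

  ⊗-assoc : ∀ p q r → (p ⊗ q) ⊗ r ≋ p ⊗ (q ⊗ r)
  ⊗-assoc []      q r = ≋-refl
  ⊗-assoc (c ∷ p) q r = begin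
    (c · q ⊕ mulX (p ⊗ q)) ⊗ r        ≈⟨ ⊗-distribʳ (c · q) (mulX (p ⊗ q)) r ⟩
    (c · q) ⊗ r ⊕ mulX (p ⊗ q) ⊗ r    ≈⟨ ⊕-cong (·-⊗ c q r) (mulX-⊗ (p ⊗ q) r) ⟩
    c · (q ⊗ r) ⊕ mulX ((p ⊗ q) ⊗ r)  ≈⟨ ⊕-congˡ (c · (q ⊗ r)) (mulX-cong (⊗-assoc p q r)) ⟩
    c · (q ⊗ r) ⊕ mulX (p ⊗ (q ⊗ r))  ∎
    where open ≋-Reasoning

  ⊗-[] : ∀ p → p ⊗ [] ≋ []
  ⊗-[] []      = ≋-refl
  ⊗-[] (c ∷ p) = ≋-trans (mulX-cong (⊗-[] p)) (≋-sym []≋0ₚ)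

  ⊗-∷ʳ : ∀ p c q → p ⊗ (c ∷ q) ≋ c · p ⊕ mulX (p ⊗ q)
  ⊗-∷ʳ []      c q = []≋0ₚ
  ⊗-∷ʳ (d ∷ p) c q = ∷-cong (~-reflexive (cong (ℤ._+ + 0) (ℤ.*-comm d c))) (begin
    d · q ⊕ p ⊗ (c ∷ q)             ≈⟨ ⊕-congˡ (d · q) (⊗-∷ʳ p c q) ⟩
    d · q ⊕ (c · p ⊕ mulX (p ⊗ q))  ≈⟨ ⊕-assoc (d · q) (c · p) (mulX (p ⊗ q)) ⟨
    (d · q ⊕ c · p) ⊕ mulX (p ⊗ q)  ≈⟨ ⊕-congʳ (mulX (p ⊗ q)) (⊕-comm (d · q) (c · p)) ⟩
    (c · p ⊕ d · q) ⊕ mulX (p ⊗ q)  ≈⟨ ⊕-assoc (c · p) (d · q) (mulX (p ⊗ q)) ⟩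
    c · p ⊕ (d · q ⊕ mulX (p ⊗ q))  ∎)
    where open ≋-Reasoning

  ⊗-comm : ∀ p q → p ⊗ q ≋ q ⊗ p
  ⊗-comm []      q = ≋-sym (⊗-[] q)
  ⊗-comm (c ∷ p) q = ≋-trans (⊕-congˡ (c · q) (mulX-cong (⊗-comm p q))) (≋-sym (⊗-∷ʳ q c p))

  ⊗-distribˡ : ∀ p q r → p ⊗ (q ⊕ r) ≋ p ⊗ q ⊕ p ⊗ r
  ⊗-distribˡ p q r = begin
    p ⊗ (q ⊕ r)    ≈⟨ ⊗-comm p (q ⊕ r) ⟩
    (q ⊕ r) ⊗ p    ≈⟨ ⊗-distribʳ q r p ⟩
    q ⊗ p ⊕ r ⊗ p  ≈⟨ ⊕-cong (⊗-comm q p) (⊗-comm r p) ⟩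
    p ⊗ q ⊕ p ⊗ r  ∎
    where open ≋-Reasoning

  ⊗-identityˡ : ∀ p → 1ₚ ⊗ p ≋ p
  ⊗-identityˡ p = ≋-trans (⊕-cong (·-identity p) (≋-sym []≋0ₚ)) (⊕-[] p)

  ⊗-zeroˡ : ∀ p → 0ₚ ⊗ p ≋ 0ₚ
  ⊗-zeroˡ p = ⊕-congʳ (mulX []) (·-zero p)

  ≋[]⇒⊗≋[] : ∀ p q → p ≋ [] → p ⊗ q ≋ []
  ≋[]⇒⊗≋[] []      q h = ≋-refl
  ≋[]⇒⊗≋[] (c ∷ p) q h = ≋-trans {q = mulX []}
    (⊕-cong {p′ = []} (coeffwise λ k → subst (_~ + 0) (sym (coeff-· c q k)) (~0⇒*~0 (coeff q k) (coeff-~ h 0)))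
                      (mulX-cong (≋[]⇒⊗≋[] p q (coeffwise λ k → coeff-~ h (suc k)))))
    (≋-sym []≋0ₚ)

  ⊗-congʳ : ∀ {p p′} q → p ≋ p′ → p ⊗ q ≋ p′ ⊗ q
  ⊗-congʳ {p} {p′} q h = ⊕-neg≋[]⇒≋ (p ⊗ q) (p′ ⊗ q) (begin
    p ⊗ q ⊕ neg (p′ ⊗ q)  ≈⟨ ⊕-congˡ (p ⊗ q) (·-⊗ ℤ.-1ℤ p′ q) ⟨
    p ⊗ q ⊕ neg p′ ⊗ q    ≈⟨ ⊗-distribʳ p (neg p′) q ⟨
    (p ⊕ neg p′) ⊗ q      ≈⟨ ≋[]⇒⊗≋[] (p ⊕ neg p′) q (≋⇒⊕-neg≋[] p p′ h) ⟩
    []                    ∎)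
    where open ≋-Reasoning

  ⊗-cong : ∀ {p p′ q q′} → p ≋ p′ → q ≋ q′ → p ⊗ q ≋ p′ ⊗ q′
  ⊗-cong {p} {p′} {q} {q′} h h′ = begin
    p ⊗ q    ≈⟨ ⊗-congʳ q h ⟩
    p′ ⊗ q   ≈⟨ ⊗-comm p′ q ⟩
    q ⊗ p′   ≈⟨ ⊗-congʳ p′ h′ ⟩
    q′ ⊗ p′  ≈⟨ ⊗-comm q′ p′ ⟩
    p′ ⊗ q′  ∎
    where open ≋-Reasoning

  ⊗-congˡ : ∀ p {q q′} → q ≋ q′ → p ⊗ q ≋ p ⊗ q′
  ⊗-congˡ p = ⊗-cong (≋-refl {p})

  polyRing : AlmostCommutativeRing 0ℓ 0ℓ
  polyRing = record
    { Carrier = Poly ; _≈_ = _≋_ ; _+_ = _⊕_ ; _*_ = _⊗_ ; -_ = neg ; 0# = 0ₚ ; 1# = 1ₚ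
    ; isAlmostCommutativeRing = record
      { isCommutativeSemiring = record
        { isSemiring = record
          { isSemiringWithoutAnnihilatingZero = record
            { +-isCommutativeMonoid = record
              { isMonoid = record
                { isSemigroup = record
                  { isMagma = record { isEquivalence = Setoid.isEquivalence ≋-setoid ; ∙-cong = ⊕-cong }
                  ; assoc = ⊕-assoc }
                ; identity = ⊕-identityˡ , ⊕-identityʳ }
              ; comm = ⊕-comm }
            ; *-cong = ⊗-cong
            ; *-assoc = ⊗-assoc
            ; *-identity = ⊗-identityˡ , λ p → ≋-trans (⊗-comm p 1ₚ) (⊗-identityˡ p)
            ; distrib = ⊗-distribˡ , λ p q r → ⊗-distribʳ q r p }
          ; zero = ⊗-zeroˡ , λ p → ≋-trans (⊗-comm p 0ₚ) (⊗-zeroˡ p) }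
        ; *-comm = ⊗-comm }
      ; -‿cong = neg-cong
      ; -‿*-distribˡ = ·-⊗ ℤ.-1ℤ
      ; -‿+-comm = neg-⊕ } }

  _~?_ : Decidable _~_
  a ~? b = map′ ~-intro n∣a-b (+ n ∣? a ℤ.- b)

  ∷-dec : ∀ {a b p q} → Dec (a ~ b) → Dec (p ≋ q) → Dec (a ∷ p ≋ b ∷ q)
  ∷-dec a~?b p≋?q = map′ (uncurry ∷-cong) (λ h → coeff-~ h 0 , coeffwise λ k → coeff-~ h (suc k))
    (a~?b ×-dec p≋?q)

  _≋?_ : Decidable _≋_
  []      ≋? []      = yes ≋-refl
  []      ≋? (b ∷ q) = map′ (≋-trans []≋0ₚ) (≋-trans (≋-sym []≋0ₚ)) (∷-dec (+ 0 ~? b) ([] ≋? q))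
  (a ∷ p) ≋? []      = map′ (λ h → ≋-trans h (≋-sym []≋0ₚ)) (λ h → ≋-trans h []≋0ₚ)
                              (∷-dec (a ~? + 0) (p ≋? []))
  (a ∷ p) ≋? (b ∷ q) = ∷-dec (a ~? b) (p ≋? q)

  σ-cong : ∀ {p q} → p ≋ q → σ p ≋ σ q
  σ-cong {p} {q} h = coeffwise λ k →
    subst₂ _~_ (sym (coeff-σ p k)) (sym (coeff-σ q k)) (*-congˡ (ℤ.-1ℤ ℤ.^ k) (coeff-~ h k))

  σ-⊕ : ∀ p q → σ (p ⊕ q) ≋ σ p ⊕ σ q
  σ-⊕ p q = coeffwise-≡ λ k → begin
    coeff (σ (p ⊕ q)) k                        ≡⟨ coeff-σ (p ⊕ q) k ⟩
    s k ℤ.* coeff (p ⊕ q) k                    ≡⟨ cong (s k ℤ.*_) (coeff-⊕ p q k) ⟩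
    s k ℤ.* (coeff p k ℤ.+ coeff q k)          ≡⟨ ℤ.*-distribˡ-+ (s k) (coeff p k) (coeff q k) ⟩
    s k ℤ.* coeff p k ℤ.+ s k ℤ.* coeff q k    ≡⟨ cong₂ ℤ._+_ (coeff-σ p k) (coeff-σ q k) ⟨
    coeff (σ p) k ℤ.+ coeff (σ q) k            ≡⟨ coeff-⊕ (σ p) (σ q) k ⟨
    coeff (σ p ⊕ σ q) k                        ∎
    where open ≡-Reasoning
          s = ℤ.-1ℤ ℤ.^_

  σ-· : ∀ c p → σ (c · p) ≋ c · σ p
  σ-· c p = coeffwise-≡ λ k → begin
    coeff (σ (c · p)) k          ≡⟨ coeff-σ (c · p) k ⟩
    s k ℤ.* coeff (c · p) k      ≡⟨ cong (s k ℤ.*_) (coeff-· c p k) ⟩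
    s k ℤ.* (c ℤ.* coeff p k)    ≡⟨ ℤ.*-assoc (s k) c (coeff p k) ⟨
    s k ℤ.* c ℤ.* coeff p k      ≡⟨ cong (ℤ._* coeff p k) (ℤ.*-comm (s k) c) ⟩
    c ℤ.* s k ℤ.* coeff p k      ≡⟨ ℤ.*-assoc c (s k) (coeff p k) ⟩
    c ℤ.* (s k ℤ.* coeff p k)    ≡⟨ cong (c ℤ.*_) (coeff-σ p k) ⟨
    c ℤ.* coeff (σ p) k          ≡⟨ coeff-· c (σ p) k ⟨
    coeff (c · σ p) k            ∎
    where open ≡-Reasoning
          s = ℤ.-1ℤ ℤ.^_

  σ-neg : ∀ p → σ (neg p) ≋ neg (σ p)
  σ-neg = σ-· ℤ.-1ℤ

  σ-⊗ : ∀ p q → σ (p ⊗ q) ≋ σ p ⊗ σ q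
  σ-⊗ []      q = ≋-refl
  σ-⊗ (a ∷ p) q = begin
    σ (a · q ⊕ mulX (p ⊗ q))            ≈⟨ σ-⊕ (a · q) (mulX (p ⊗ q)) ⟩
    σ (a · q) ⊕ mulX (neg (σ (p ⊗ q)))  ≈⟨ ⊕-cong (σ-· a q) (mulX-cong (neg-cong (σ-⊗ p q))) ⟩
    a · σ q ⊕ mulX (neg (σ p ⊗ σ q))    ≈⟨ ⊕-congˡ (a · σ q) (mulX-cong (·-⊗ ℤ.-1ℤ (σ p) (σ q))) ⟨
    a · σ q ⊕ mulX (neg (σ p) ⊗ σ q)    ∎
    where open ≋-Reasoning

-- A complete ring solver for polynomials modulo n

module PolySolver (n : ℕ) .{{_ : NonZero n}} where

  open Congruence n

  -- ℤ/nℤ as the residues 0, …, n − 1, so that equal coefficients are syntactically equal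
  residues : RawRing 0ℓ 0ℓ
  residues = record
    { Carrier = ℕ ; _≈_ = _≡_
    ; _+_ = λ a b → (a ℕ.+ b) ℕ.% n
    ; _*_ = λ a b → (a ℕ.* b) ℕ.% n
    ; -_ = λ a → ((n ℕ.∸ 1) ℕ.* a) ℕ.% n
    ; 0# = 0 ; 1# = 1 ℕ.% n }

  m%n~m : ∀ m → + (m ℕ.% n) ~ + m
  m%n~m m = ~-via (∣m⇒∣-m (divides (+ (m ℕ./ n)) (ℤ.pos-* (m ℕ./ n) n))) (begin
    ℤ.- + qn                ≡⟨ solve 2 (λ r qn → :- qn := r :- (r :+ qn)) refl (+ r) (+ qn) ⟩
    + r ℤ.- (+ r ℤ.+ + qn)  ≡⟨ cong (λ z → + r ℤ.- z) (ℤ.pos-+ r qn) ⟨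
    + r ℤ.- + (r ℕ.+ qn)    ≡⟨ cong (λ z → + r ℤ.- + z) (ℕ.m≡m%n+[m/n]*n m n) ⟨
    + r ℤ.- + m             ∎)
    where open ≡-Reasoning
          open +-*-Solver
          r = m ℕ.% n
          qn = m ℕ./ n ℕ.* n

  [n∸1]*a~-a : ∀ a → + ((n ℕ.∸ 1) ℕ.* a) ~ ℤ.- + a
  [n∸1]*a~-a a = ~-via (divides (+ a) (ℤ.pos-* a n)) (begin
    + (a ℕ.* n)                      ≡⟨ cong +_ (ℕ.*-comm a n) ⟩
    + (n ℕ.* a)                      ≡⟨ cong (λ z → + (z ℕ.* a)) (ℕ.suc-pred n) ⟨
    + a ℤ.+ + ((n ℕ.∸ 1) ℕ.* a)      ≡⟨ ℤ.+-comm (+ a) (+ ((n ℕ.∸ 1) ℕ.* a)) ⟩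
    + ((n ℕ.∸ 1) ℕ.* a) ℤ.+ + a      ≡⟨ cong (λ z → + ((n ℕ.∸ 1) ℕ.* a) ℤ.+ z) (ℤ.neg-involutive (+ a)) ⟨
    + ((n ℕ.∸ 1) ℕ.* a) ℤ.- ℤ.- + a  ∎)
    where open ≡-Reasoning

  residue-const : residues -Raw-AlmostCommutative⟶ polyRing
  residue-const = record
    { ⟦_⟧    = λ a → const (+ a)
    ; +-homo = λ a b → ∷-cong (m%n~m (a ℕ.+ b)) ≋-refl
    ; *-homo = λ a b → ∷-cong (~-trans (m%n~m (a ℕ.* b))
                                       (~-reflexive (trans (ℤ.pos-* a b) (sym (ℤ.+-identityʳ _))))) ≋-refl
    ; -‿homo = λ a → ∷-cong (~-trans (m%n~m _)
                                       (subst (+ ((n ℕ.∸ 1) ℕ.* a) ~_) (sym (ℤ.-1*i≡-i (+ a))) ([n∸1]*a~-a a))) ≋-refl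
    ; 0-homo = ≋-refl
    ; 1-homo = ∷-cong (m%n~m 1) ≋-refl }

  _≟-residue_ : ∀ a b → Maybe (const (+ a) ≋ const (+ b))
  a ≟-residue b with a ℕ.≟ b
  ... | yes refl = just ≋-refl
  ... | no _     = nothing

  open RingSolver residues polyRing residue-const _≟-residue_ public
    hiding (prove; solve; _:=_)

  -- The Horner forms of Algebra.Solver.Ring keep the zero coefficients produced by
  -- cancellation (such as 2 + 2 ≡ 0 modulo 4). Re-normalising drops them, so that
  -- polynomials that are equal over ℤ/nℤ get identical normal forms.
  mutual
    canonH : ∀ {m} → HNF (suc m) → HNF (suc m)
    canonH ∅         = ∅
    canonH (p *x+ c) = canonH p *x+HN canonN c

    canonN : ∀ {m} → Normal m → Normal m
    canonN (con c)  = con c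
    canonN (poly p) = poly (canonH p)

  mutual
    canonH-correct : ∀ {m} (p : HNF (suc m)) ρ → ⟦ canonH p ⟧H ρ ≋ ⟦ p ⟧H ρ
    canonH-correct ∅         ρ       = ≋-refl
    canonH-correct (p *x+ c) (x ∷ ρ) = ≋-trans (*x+HN≈*x+ (canonH p) (canonN c) (x ∷ ρ))
      (⊕-cong (⊗-congʳ x (canonH-correct p (x ∷ ρ))) (canonN-correct c ρ))

    canonN-correct : ∀ {m} (p : Normal m) ρ → ⟦ canonN p ⟧N ρ ≋ ⟦ p ⟧N ρ
    canonN-correct (con c)  ρ = ≋-refl
    canonN-correct (poly p) ρ = canonH-correct p ρ

  ⟦_⟧⇓ : ∀ {m} → Polynomial m → Vec Poly m → Poly
  ⟦ p ⟧⇓ ρ = ⟦ canonN (normalise p) ⟧N ρ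

  correct⇓ : ∀ {m} (p : Polynomial m) ρ → ⟦ p ⟧⇓ ρ ≋ ⟦ p ⟧ ρ
  correct⇓ p ρ = ≋-trans (canonN-correct (normalise p) ρ) (correct p ρ)

  open Relation.Binary.Reflection ≋-setoid var ⟦_⟧ ⟦_⟧⇓ correct⇓ public
    using (prove; solve) renaming (_⊜_ to _:=_)

  open import Algebra.Properties.Semiring.Exp (AlmostCommutativeRing.semiring polyRing)
    using (_^_; ^-congˡ)

  ⟦⟧-cong : ∀ {m} (e : Polynomial m) {ρ ρ′} → Pointwise _≋_ ρ ρ′ → ⟦ e ⟧ ρ ≋ ⟦ e ⟧ ρ′
  ⟦⟧-cong (op [+] e f) ρ≋ρ′ = ⊕-cong (⟦⟧-cong e ρ≋ρ′) (⟦⟧-cong f ρ≋ρ′)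
  ⟦⟧-cong (op [*] e f) ρ≋ρ′ = ⊗-cong (⟦⟧-cong e ρ≋ρ′) (⟦⟧-cong f ρ≋ρ′)
  ⟦⟧-cong (con c)      ρ≋ρ′ = ≋-refl
  ⟦⟧-cong (var i)      ρ≋ρ′ = Pointwise.lookup ρ≋ρ′ i
  ⟦⟧-cong (e :^ k)     ρ≋ρ′ = ^-congˡ k (⟦⟧-cong e ρ≋ρ′)
  ⟦⟧-cong (:- e)       ρ≋ρ′ = neg-cong (⟦⟧-cong e ρ≋ρ′)

  σ-^ : ∀ p k → σ (p ^ k) ≋ σ p ^ k
  σ-^ p zero    = ≋-refl
  σ-^ p (suc k) = ≋-trans (σ-⊗ p (p ^ k)) (⊗-congˡ (σ p) (σ-^ p k))

  σ-⟦⟧ : ∀ {m} (e : Polynomial m) ρ → σ (⟦ e ⟧ ρ) ≋ ⟦ e ⟧ (Vec.map σ ρ)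
  σ-⟦⟧ (op [+] e f) ρ = ≋-trans (σ-⊕ (⟦ e ⟧ ρ) (⟦ f ⟧ ρ)) (⊕-cong (σ-⟦⟧ e ρ) (σ-⟦⟧ f ρ))
  σ-⟦⟧ (op [*] e f) ρ = ≋-trans (σ-⊗ (⟦ e ⟧ ρ) (⟦ f ⟧ ρ)) (⊗-cong (σ-⟦⟧ e ρ) (σ-⟦⟧ f ρ))
  σ-⟦⟧ (con c)      ρ = ≋-refl
  σ-⟦⟧ (var i)      ρ = ≋-reflexive (sym (Vec.lookup-map i σ ρ))
  σ-⟦⟧ (e :^ k)     ρ = ≋-trans (σ-^ (⟦ e ⟧ ρ) k) (^-congˡ k (σ-⟦⟧ e ρ))
  σ-⟦⟧ (:- e)       ρ = ≋-trans (σ-neg (⟦ e ⟧ ρ)) (neg-cong (σ-⟦⟧ e ρ))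

record Mat (A : Set) : Set where
  constructor mat
  field e11 e12 e21 e22 : A
open Mat public

module Matrices (R : RawRing 0ℓ 0ℓ) where

  open RawRing R

  infixl 7 _⊠_
  _⊠_ : Mat Carrier → Mat Carrier → Mat Carrier
  A ⊠ B = mat (e11 A * e11 B + e12 A * e21 B) (e11 A * e12 B + e12 A * e22 B)
              (e21 A * e11 B + e22 A * e21 B) (e21 A * e12 B + e22 A * e22 B)

  I N K : Mat Carrier
  I = mat 1# 0# 0# 1#
  N = mat 1# 1# 0# 1#
  K = mat 0# (- 1#) 1# 0#

  J : Carrier → Mat Carrier
  J x = mat 0# (- x) 1# 0#

  scaleRow₂ : Carrier → Mat Carrier → Mat Carrier
  scaleRow₂ x A = mat (e11 A) (e12 A) (x * e21 A) (x * e22 A)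

  negateRow₂ : Mat Carrier → Mat Carrier
  negateRow₂ A = mat (e11 A) (e12 A) (- e21 A) (- e22 A)

module Ansatz (R : RawRing 0ℓ 0ℓ) where

  open RawRing R
  open Matrices R

  infixl 6 _-_
  _-_ : Carrier → Carrier → Carrier
  x - y = x + - y

  two : Carrier
  two = 1# + 1#

  -- scaledConvergents (2^(k+1) − 2) modulo 4, with s = S_k = u + v, y = x^(2^k), and ε
  -- telling whether k is even
  ansatz : Bool → (x u v y : Carrier) → Mat Carrier
  ansatz ε x u v y =
    mat (1# + 2εx + two * u)         (1# - x + two * y - s * s + two * (x * v))
        (x + s * s - two * (x * v))  (x * (1# + 2εx + two * s))
    where s = u + v
          2εx = if ε then two * x else 0#

  -- x^(2^k) in terms of s = S_k, by S_k² = S_(k+1) − x + 2w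
  nextPower : (x s w : Carrier) → Carrier
  nextPower x s w = s * s - s + x - two * w

  -- x ↦ −x only changes the summand x of S_k, which lies in u exactly when k is even
  doubling-lhs doubling-rhs : Bool → (x u v w : Carrier) → Mat Carrier
  doubling-lhs ε x u v w =
    (negateRow₂ (ansatz ε (- x) (if ε then u - two * x else u) (if ε then v else v - two * x) y) ⊠ K)
      ⊠ ansatz ε x u v y
    where y = nextPower x (u + v) w
  doubling-rhs ε x u v w = ansatz (not ε) x v (u + y) (y * y)
    where y = nextPower x (u + v) w

open Congruence 4
open PolySolver 4

-- Formulas stated over a raw ring, read in solver syntax, evaluate definitionally to the same
-- formulas read in Poly; this is how prove-Mat and the solver reach matrix identities.
exprRing : ℕ → RawRing 0ℓ 0ℓ
exprRing m = record
  { Carrier = Polynomial m ; _≈_ = _≡_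
  ; _+_ = _:+_ ; _*_ = _:*_ ; -_ = :-_ ; 0# = con 0 ; 1# = con 1 }

polyRawRing : RawRing 0ℓ 0ℓ
polyRawRing = AlmostCommutativeRing.rawRing polyRing

open Matrices polyRawRing
module Expr {m} = Matrices (exprRing m)

evalMat : ∀ {m} → Mat (Polynomial m) → Vec Poly m → Mat Poly
evalMat A ρ = mat (⟦ e11 A ⟧ ρ) (⟦ e12 A ⟧ ρ) (⟦ e21 A ⟧ ρ) (⟦ e22 A ⟧ ρ)

infix 4 _≋M_ _≋M?_
record _≋M_ (A B : Mat Poly) : Set where
  constructor mat≋
  field ≋11 : e11 A ≋ e11 B
        ≋12 : e12 A ≋ e12 B
        ≋21 : e21 A ≋ e21 B
        ≋22 : e22 A ≋ e22 B
open _≋M_ public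

≋M-setoid : Setoid 0ℓ 0ℓ
≋M-setoid = record
  { Carrier = Mat Poly ; _≈_ = _≋M_
  ; isEquivalence = record
    { refl  = mat≋ ≋-refl ≋-refl ≋-refl ≋-refl
    ; sym   = λ (mat≋ a b c d) → mat≋ (≋-sym a) (≋-sym b) (≋-sym c) (≋-sym d)
    ; trans = λ (mat≋ a b c d) (mat≋ a′ b′ c′ d′) →
                mat≋ (≋-trans a a′) (≋-trans b b′) (≋-trans c c′) (≋-trans d d′) } }

open Setoid ≋M-setoid using ()
  renaming (refl to ≋M-refl; reflexive to ≋M-reflexive; sym to ≋M-sym; trans to ≋M-trans)
module ≋M-Reasoning = Relation.Binary.Reasoning.Setoid ≋M-setoid

_≋M?_ : Decidable _≋M_
A ≋M? B = map′ (λ ((a , b) , (c , d)) → mat≋ a b c d) (λ (mat≋ a b c d) → (a , b) , (c , d))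
  (((e11 A ≋? e11 B) ×-dec (e12 A ≋? e12 B)) ×-dec ((e21 A ≋? e21 B) ×-dec (e22 A ≋? e22 B)))

prove-Mat : ∀ {m} ρ (A B : Mat (Polynomial m)) →
  ⟦ e11 A ⟧⇓ ρ ≋ ⟦ e11 B ⟧⇓ ρ → ⟦ e12 A ⟧⇓ ρ ≋ ⟦ e12 B ⟧⇓ ρ →
  ⟦ e21 A ⟧⇓ ρ ≋ ⟦ e21 B ⟧⇓ ρ → ⟦ e22 A ⟧⇓ ρ ≋ ⟦ e22 B ⟧⇓ ρ → evalMat A ρ ≋M evalMat B ρ
prove-Mat ρ A B h11 h12 h21 h22 =
  mat≋ (prove ρ (e11 A) (e11 B) h11) (prove ρ (e12 A) (e12 B) h12)
       (prove ρ (e21 A) (e21 B) h21) (prove ρ (e22 A) (e22 B) h22)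

evalMat-cong : ∀ {m} (A : Mat (Polynomial m)) {ρ ρ′} → Pointwise _≋_ ρ ρ′ → evalMat A ρ ≋M evalMat A ρ′
evalMat-cong A h = mat≋ (⟦⟧-cong (e11 A) h) (⟦⟧-cong (e12 A) h) (⟦⟧-cong (e21 A) h) (⟦⟧-cong (e22 A) h)

⊠-cong : ∀ {A A′ B B′} → A ≋M A′ → B ≋M B′ → A ⊠ B ≋M A′ ⊠ B′
⊠-cong (mat≋ a b c d) (mat≋ e f g h) =
  mat≋ (⊕-cong (⊗-cong a e) (⊗-cong b g)) (⊕-cong (⊗-cong a f) (⊗-cong b h))
       (⊕-cong (⊗-cong c e) (⊗-cong d g)) (⊕-cong (⊗-cong c f) (⊗-cong d h))

⊠-congˡ : ∀ A {B B′} → B ≋M B′ → A ⊠ B ≋M A ⊠ B′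
⊠-congˡ A = ⊠-cong (≋M-refl {A})

⊠-congʳ : ∀ {A A′} B → A ≋M A′ → A ⊠ B ≋M A′ ⊠ B
⊠-congʳ B A≋A′ = ⊠-cong A≋A′ (≋M-refl {B})

⊠-assoc : ∀ A B C → (A ⊠ B) ⊠ C ≋M A ⊠ (B ⊠ C)
⊠-assoc (mat a b c d) (mat e f g h) (mat i j k l) =
  prove-Mat (a ∷ b ∷ c ∷ d ∷ e ∷ f ∷ g ∷ h ∷ i ∷ j ∷ k ∷ l ∷ [])
    ((A Expr.⊠ B) Expr.⊠ C) (A Expr.⊠ (B Expr.⊠ C)) ≋-refl ≋-refl ≋-refl ≋-refl
  where
  A = mat (var (# 0)) (var (# 1)) (var (# 2)) (var (# 3))
  B = mat (var (# 4)) (var (# 5)) (var (# 6)) (var (# 7))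
  C = mat (var (# 8)) (var (# 9)) (var (# 10)) (var (# 11))

⊠-identityˡ : ∀ A → I ⊠ A ≋M A
⊠-identityˡ (mat a b c d) = prove-Mat (a ∷ b ∷ c ∷ d ∷ []) (Expr.I Expr.⊠ A) A ≋-refl ≋-refl ≋-refl ≋-refl
  where A = mat (var (# 0)) (var (# 1)) (var (# 2)) (var (# 3))

negateRow₂-cong : ∀ {A B} → A ≋M B → negateRow₂ A ≋M negateRow₂ B
negateRow₂-cong (mat≋ a b c d) = mat≋ a b (neg-cong c) (neg-cong d)

scaleRow₂-cong : ∀ x {A B} → A ≋M B → scaleRow₂ x A ≋M scaleRow₂ x B
scaleRow₂-cong x (mat≋ a b c d) = mat≋ a b (⊗-congˡ x c) (⊗-congˡ x d)

σM : Mat Poly → Mat Poly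
σM A = mat (σ (e11 A)) (σ (e12 A)) (σ (e21 A)) (σ (e22 A))

σM-cong : ∀ {A B} → A ≋M B → σM A ≋M σM B
σM-cong (mat≋ a b c d) = mat≋ (σ-cong a) (σ-cong b) (σ-cong c) (σ-cong d)

σM-⊠ : ∀ A B → σM (A ⊠ B) ≋M σM A ⊠ σM B
σM-⊠ A B = mat≋ (σ-entry (e11 A) (e12 A) (e11 B) (e21 B)) (σ-entry (e11 A) (e12 A) (e12 B) (e22 B))
                (σ-entry (e21 A) (e22 A) (e11 B) (e21 B)) (σ-entry (e21 A) (e22 A) (e12 B) (e22 B))
  where
  σ-entry : ∀ a b c d → σ (a ⊗ c ⊕ b ⊗ d) ≋ σ a ⊗ σ c ⊕ σ b ⊗ σ d
  σ-entry a b c d = ≋-trans (σ-⊕ (a ⊗ c) (b ⊗ d)) (⊕-cong (σ-⊗ a c) (σ-⊗ b d))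

σM-evalMat : ∀ {m} (A : Mat (Polynomial m)) ρ → σM (evalMat A ρ) ≋M evalMat A (Vec.map σ ρ)
σM-evalMat A ρ = mat≋ (σ-⟦⟧ (e11 A) ρ) (σ-⟦⟧ (e12 A) ρ) (σ-⟦⟧ (e21 A) ρ) (σ-⟦⟧ (e22 A) ρ)

-- The convergents as a matrix product, and the doubling relation

convergents : ℕ → Mat Poly
convergents n = mat (P (suc n)) (Q (suc n)) (P n) (Q n)

step : ℤ → Mat Poly
step c = mat 1ₚ (mulX (const c)) 1ₚ 0ₚ

stepProduct : (ℕ → ℤ) → ℕ → ℕ → Mat Poly
stepProduct f lo zero    = I
stepProduct f lo (suc l) = step (f (lo ℕ.+ l)) ⊠ stepProduct f lo l

const-⊗ : ∀ c p → const c ⊗ p ≋ c · p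
const-⊗ c p = ≋-trans (⊕-congˡ (c · p) (≋-sym []≋0ₚ)) (⊕-[] (c · p))

convergents-suc : ∀ n → convergents (suc n) ≋M step (a (suc (suc n))) ⊠ convergents n
convergents-suc n = ≋M-sym (mat≋ (step-row (P (suc n)) (P n)) (step-row (Q (suc n)) (Q n))
                                 (copy-row (P (suc n)) (P n)) (copy-row (Q (suc n)) (Q n)))
  where
  c = a (suc (suc n))
  step-row : ∀ p q → 1ₚ ⊗ p ⊕ mulX (const c) ⊗ q ≋ p ⊕ mulX (c · q)
  step-row p q = ⊕-cong (⊗-identityˡ p) (≋-trans (mulX-⊗ (const c) q) (mulX-cong (const-⊗ c q)))
  copy-row : ∀ p q → 1ₚ ⊗ p ⊕ 0ₚ ⊗ q ≋ p
  copy-row p q = ≋-trans (⊕-cong (⊗-identityˡ p) (⊗-zeroˡ q)) (⊕-identityʳ p)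

convergents-product : ∀ n → convergents n ≋M stepProduct a 1 (suc n) ⊠ N
convergents-product zero    = from-yes (convergents 0 ≋M? stepProduct a 1 1 ⊠ N)
convergents-product (suc n) = begin
  convergents (suc n)                     ≈⟨ convergents-suc n ⟩
  step c ⊠ convergents n                  ≈⟨ ⊠-congˡ (step c) (convergents-product n) ⟩
  step c ⊠ (stepProduct a 1 (suc n) ⊠ N)  ≈⟨ ⊠-assoc (step c) (stepProduct a 1 (suc n)) N ⟨
  stepProduct a 1 (suc (suc n)) ⊠ N       ∎
  where open ≋M-Reasoning
        c = a (suc (suc n))

stepProduct-split : ∀ f lo l l′ →
  stepProduct f lo (l ℕ.+ l′) ≋M stepProduct f (lo ℕ.+ l) l′ ⊠ stepProduct f lo l
stepProduct-split f lo l zero rewrite ℕ.+-identityʳ l = ≋M-sym (⊠-identityˡ (stepProduct f lo l))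
stepProduct-split f lo l (suc l′) rewrite ℕ.+-suc l l′ | sym (ℕ.+-assoc lo l l′) = begin
  M ⊠ stepProduct f lo (l ℕ.+ l′)                         ≈⟨ ⊠-congˡ M (stepProduct-split f lo l l′) ⟩
  M ⊠ (stepProduct f (lo ℕ.+ l) l′ ⊠ stepProduct f lo l)
    ≈⟨ ⊠-assoc M (stepProduct f (lo ℕ.+ l) l′) (stepProduct f lo l) ⟨
  (M ⊠ stepProduct f (lo ℕ.+ l) l′) ⊠ stepProduct f lo l  ∎
  where open ≋M-Reasoning
        M = step (f (lo ℕ.+ l ℕ.+ l′))

σM-step : ∀ c → σM (step c) ≋M step (ℤ.- c)
σM-step c = mat≋ ≋-refl (mulX-cong (∷-cong (~-reflexive (ℤ.-1*i≡-i c)) ≋-refl)) ≋-refl ≋-refl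

stepProduct-σ : ∀ f g lo l → (∀ i → i ℕ.< l → f (lo ℕ.+ i) ≡ ℤ.- g i) →
  stepProduct f lo l ≋M σM (stepProduct g 0 l)
stepProduct-σ f g lo zero    h = ≋M-refl
stepProduct-σ f g lo (suc l) h = begin
  step (f (lo ℕ.+ l)) ⊠ stepProduct f lo l  ≈⟨ ⊠-cong (≋M-reflexive (cong step (h l ℕ.≤-refl)))
                                                      (stepProduct-σ f g lo l (λ i i<l → h i (ℕ.m≤n⇒m≤1+n i<l))) ⟩
  step (ℤ.- g l) ⊠ σM (stepProduct g 0 l)   ≈⟨ ⊠-congʳ (σM (stepProduct g 0 l)) (σM-step (g l)) ⟨
  σM (step (g l)) ⊠ σM (stepProduct g 0 l)  ≈⟨ σM-⊠ (step (g l)) (stepProduct g 0 l) ⟨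
  σM (stepProduct g 0 (suc l))              ∎
  where open ≋M-Reasoning

⊠-reassociate : ∀ A B x → ((A ⊠ (N ⊠ J x)) ⊠ B) ⊠ N ≋M ((A ⊠ N) ⊠ J x) ⊠ (B ⊠ N)
⊠-reassociate (mat a b c d) (mat e f g h) x =
  prove-Mat (a ∷ b ∷ c ∷ d ∷ e ∷ f ∷ g ∷ h ∷ x ∷ [])
    (((A Expr.⊠ (Expr.N Expr.⊠ Expr.J x′)) Expr.⊠ B) Expr.⊠ Expr.N)
    (((A Expr.⊠ Expr.N) Expr.⊠ Expr.J x′) Expr.⊠ (B Expr.⊠ Expr.N))
    ≋-refl ≋-refl ≋-refl ≋-refl
  where
  A = mat (var (# 0)) (var (# 1)) (var (# 2)) (var (# 3))
  B = mat (var (# 4)) (var (# 5)) (var (# 6)) (var (# 7))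
  x′ = var (# 8)

convergents-doubling : ∀ k n → suc (suc n) ≡ 2 ℕ.^ k →
  convergents (n ℕ.+ suc (suc n)) ≋M (σM (convergents n) ⊠ J X) ⊠ convergents n
convergents-doubling k n L≡2^k = begin
  convergents (n ℕ.+ L)                          ≈⟨ convergents-product (n ℕ.+ L) ⟩
  stepProduct a 1 (suc n ℕ.+ L) ⊠ N              ≈⟨ ⊠-congʳ N (stepProduct-split a 1 (suc n) L) ⟩
  (stepProduct a L L ⊠ G) ⊠ N                    ≈⟨ ⊠-congʳ N (⊠-congʳ G second-block) ⟩
  (σM (stepProduct a 0 (1 ℕ.+ suc n)) ⊠ G) ⊠ N
    ≈⟨ ⊠-congʳ N (⊠-congʳ G (σM-cong (stepProduct-split a 0 1 (suc n)))) ⟩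
  (σM (G ⊠ stepProduct a 0 1) ⊠ G) ⊠ N           ≈⟨ ⊠-congʳ N (⊠-congʳ G (σM-⊠ G (stepProduct a 0 1))) ⟩
  ((σM G ⊠ σM (stepProduct a 0 1)) ⊠ G) ⊠ N      ≈⟨ ⊠-congʳ N (⊠-congʳ G (⊠-congˡ (σM G) first-step)) ⟩
  ((σM G ⊠ (N ⊠ J X)) ⊠ G) ⊠ N                   ≈⟨ ⊠-reassociate (σM G) G X ⟩
  ((σM G ⊠ σM N) ⊠ J X) ⊠ (G ⊠ N)                ≈⟨ ⊠-congʳ (G ⊠ N) (⊠-congʳ (J X) (σM-⊠ G N)) ⟨
  (σM (G ⊠ N) ⊠ J X) ⊠ (G ⊠ N)                   ≈⟨ ⊠-cong (⊠-congʳ (J X) (σM-cong C≋)) C≋ ⟨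
  (σM (convergents n) ⊠ J X) ⊠ convergents n     ∎
  where
  open ≋M-Reasoning
  L = suc (suc n)
  G = stepProduct a 1 (suc n)
  C≋ = convergents-product n
  first-step : σM (stepProduct a 0 1) ≋M N ⊠ J X
  first-step = from-yes (σM (stepProduct a 0 1) ≋M? N ⊠ J X)
  second-block : stepProduct a L L ≋M σM (stepProduct a 0 L)
  second-block = stepProduct-σ a a L L λ i i<L →
    subst (λ M → a (M ℕ.+ i) ≡ ℤ.- a i) (sym L≡2^k) (t-block k i (subst (i ℕ.<_) L≡2^k i<L))

scaledConvergents : ℕ → Mat Poly
scaledConvergents n = scaleRow₂ X (convergents n)

scaling-identity : ∀ x a b c d B →
  scaleRow₂ x ((mat a b c d ⊠ J x) ⊠ B) ≋M (negateRow₂ (mat a b (neg x ⊗ c) (neg x ⊗ d)) ⊠ K) ⊠ scaleRow₂ x B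
scaling-identity x a b c d (mat e f g h) =
  prove-Mat (x ∷ a ∷ b ∷ c ∷ d ∷ e ∷ f ∷ g ∷ h ∷ [])
    (Expr.scaleRow₂ x′ ((mat a′ b′ c′ d′ Expr.⊠ Expr.J x′) Expr.⊠ B))
    ((Expr.negateRow₂ (mat a′ b′ (:- x′ :* c′) (:- x′ :* d′)) Expr.⊠ Expr.K) Expr.⊠ Expr.scaleRow₂ x′ B)
    ≋-refl ≋-refl ≋-refl ≋-refl
  where
  x′ = var (# 0)
  a′ = var (# 1)
  b′ = var (# 2)
  c′ = var (# 3)
  d′ = var (# 4)
  B = mat (var (# 5)) (var (# 6)) (var (# 7)) (var (# 8))

scaled-conjugation : ∀ A B →
  scaleRow₂ X ((σM A ⊠ J X) ⊠ B) ≋M (negateRow₂ (σM (scaleRow₂ X A)) ⊠ K) ⊠ scaleRow₂ X B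
scaled-conjugation A@(mat a b c d) B = begin
  scaleRow₂ X ((σM A ⊠ J X) ⊠ B)
    ≈⟨ scaling-identity X (σ a) (σ b) (σ c) (σ d) B ⟩
  (negateRow₂ (mat (σ a) (σ b) (neg X ⊗ σ c) (neg X ⊗ σ d)) ⊠ K) ⊠ scaleRow₂ X B
    ≈⟨ ⊠-congʳ (scaleRow₂ X B) (⊠-congʳ K (negateRow₂-cong σ-scaleRow₂)) ⟨
  (negateRow₂ (σM (scaleRow₂ X A)) ⊠ K) ⊠ scaleRow₂ X B
    ∎
  where
  open ≋M-Reasoning
  σ-scaleRow₂ : σM (scaleRow₂ X A) ≋M mat (σ a) (σ b) (neg X ⊗ σ c) (neg X ⊗ σ d)
  σ-scaleRow₂ = mat≋ ≋-refl ≋-refl (σ-⊗ X c) (σ-⊗ X d)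

2≤2^e : ∀ {e} → 1 ℕ.≤ e → 2 ℕ.≤ 2 ℕ.^ e
2≤2^e {suc e} _ = ℕ.*-monoʳ-≤ 2 (ℕ.m^n>0 2 e)

2^e∸2+2 : ∀ {e} → 1 ℕ.≤ e → suc (suc (2 ℕ.^ e ℕ.∸ 2)) ≡ 2 ℕ.^ e
2^e∸2+2 {e} 1≤e = trans (ℕ.+-comm 2 (2 ℕ.^ e ℕ.∸ 2)) (ℕ.m∸n+n≡m (2≤2^e 1≤e))

scaled-doubling : ∀ {e} → 1 ℕ.≤ e →
  scaledConvergents (2 ℕ.^ suc e ℕ.∸ 2) ≋M
    (negateRow₂ (σM (scaledConvergents (2 ℕ.^ e ℕ.∸ 2))) ⊠ K) ⊠ scaledConvergents (2 ℕ.^ e ℕ.∸ 2)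
scaled-doubling {e} 1≤e =
  subst (λ i → scaledConvergents i ≋M (negateRow₂ (σM (scaledConvergents n)) ⊠ K) ⊠ scaledConvergents n) index
    (≋M-trans (scaleRow₂-cong X (convergents-doubling e n (2^e∸2+2 1≤e)))
              (scaled-conjugation (convergents n) (convergents n)))
  where
  n = 2 ℕ.^ e ℕ.∸ 2
  index : n ℕ.+ suc (suc n) ≡ 2 ℕ.^ suc e ℕ.∸ 2
  index = begin
    n ℕ.+ suc (suc n)            ≡⟨ cong (n ℕ.+_) (2^e∸2+2 1≤e) ⟩
    n ℕ.+ 2 ℕ.^ e                ≡⟨ ℕ.+-∸-comm (2 ℕ.^ e) (2≤2^e 1≤e) ⟨
    (2 ℕ.^ e ℕ.+ 2 ℕ.^ e) ℕ.∸ 2  ≡⟨ cong (ℕ._∸ 2) (2^suc e) ⟨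
    2 ℕ.^ suc e ℕ.∸ 2            ∎
    where open ≡-Reasoning

open Ansatz polyRawRing
module ExprAnsatz {m} = Ansatz (exprRing m)

doubling-identity : ∀ ε x u v w → doubling-lhs ε x u v w ≋M doubling-rhs ε x u v w
doubling-identity false x u v w =
  prove-Mat (x ∷ u ∷ v ∷ w ∷ [])
    (ExprAnsatz.doubling-lhs false x′ u′ v′ w′) (ExprAnsatz.doubling-rhs false x′ u′ v′ w′)
    ≋-refl ≋-refl ≋-refl ≋-refl
  where x′ = var (# 0); u′ = var (# 1); v′ = var (# 2); w′ = var (# 3)
doubling-identity true x u v w =
  prove-Mat (x ∷ u ∷ v ∷ w ∷ [])
    (ExprAnsatz.doubling-lhs true x′ u′ v′ w′) (ExprAnsatz.doubling-rhs true x′ u′ v′ w′)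
    ≋-refl ≋-refl ≋-refl ≋-refl
  where x′ = var (# 0); u′ = var (# 1); v′ = var (# 2); w′ = var (# 3)

ansatzExpr : Bool → Mat (Polynomial 4)
ansatzExpr ε = ExprAnsatz.ansatz ε (var (# 0)) (var (# 1)) (var (# 2)) (var (# 3))

σ-ansatz : ∀ ε x u v y → σM (ansatz ε x u v y) ≋M ansatz ε (σ x) (σ u) (σ v) (σ y)
σ-ansatz false x u v y = σM-evalMat (ansatzExpr false) (x ∷ u ∷ v ∷ y ∷ [])
σ-ansatz true  x u v y = σM-evalMat (ansatzExpr true) (x ∷ u ∷ v ∷ y ∷ [])

ansatz-cong : ∀ ε {x x′ u u′ v v′ y y′} → x ≋ x′ → u ≋ u′ → v ≋ v′ → y ≋ y′ →
  ansatz ε x u v y ≋M ansatz ε x′ u′ v′ y′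
ansatz-cong false x≋ u≋ v≋ y≋ = evalMat-cong (ansatzExpr false) (x≋ ∷ u≋ ∷ v≋ ∷ y≋ ∷ [])
ansatz-cong true  x≋ u≋ v≋ y≋ = evalMat-cong (ansatzExpr true) (x≋ ∷ u≋ ∷ v≋ ∷ y≋ ∷ [])

ansatz-step : ∀ ε {e u v y w} → 1 ℕ.≤ e →
  scaledConvergents (2 ℕ.^ e ℕ.∸ 2) ≋M ansatz ε X u v y →
  σ u ≋ (if ε then u - two ⊗ X else u) → σ v ≋ (if ε then v else v - two ⊗ X) → σ y ≋ y →
  y ≋ nextPower X (u ⊕ v) w →
  scaledConvergents (2 ℕ.^ suc e ℕ.∸ 2) ≋M ansatz (not ε) X v (u ⊕ y) (y ⊗ y)
ansatz-step ε {e} {u} {v} {y} {w} 1≤e C≋ σu σv σy y≋ = begin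
  scaledConvergents (2 ℕ.^ suc e ℕ.∸ 2)
    ≈⟨ scaled-doubling 1≤e ⟩
  (negateRow₂ (σM C) ⊠ K) ⊠ C
    ≈⟨ ⊠-cong (⊠-congʳ K (negateRow₂-cong (σM-cong C≋))) C≋ ⟩
  (negateRow₂ (σM (ansatz ε X u v y)) ⊠ K) ⊠ ansatz ε X u v y
    ≈⟨ ⊠-cong (⊠-congʳ K (negateRow₂-cong σ-C)) (ansatz-cong ε ≋-refl ≋-refl ≋-refl y≋) ⟩
  doubling-lhs ε X u v w
    ≈⟨ doubling-identity ε X u v w ⟩
  doubling-rhs ε X u v w
    ≈⟨ ansatz-cong (not ε) ≋-refl ≋-refl (⊕-congˡ u y≋) (⊗-cong y≋ y≋) ⟨
  ansatz (not ε) X v (u ⊕ y) (y ⊗ y)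
    ∎
  where
  open ≋M-Reasoning
  C = scaledConvergents (2 ℕ.^ e ℕ.∸ 2)
  σ-C : σM (ansatz ε X u v y) ≋M
        ansatz ε (neg X) (if ε then u - two ⊗ X else u) (if ε then v else v - two ⊗ X) (nextPower X (u ⊕ v) w)
  σ-C = ≋M-trans (σ-ansatz ε X u v y) (ansatz-cong ε ≋-refl σu σv (≋-trans σy y≋))

mono-⊗ : ∀ i j → mono i ⊗ mono j ≋ mono (i ℕ.+ j)
mono-⊗ zero    j = ⊗-identityˡ (mono j)
mono-⊗ (suc i) j = ≋-trans (mulX-⊗ (mono i) (mono j)) (mulX-cong (mono-⊗ i j))

mono-square : ∀ {k k′} → suc k ≡ k′ → mono (2 ℕ.^ k) ⊗ mono (2 ℕ.^ k) ≋ mono (2 ℕ.^ k′)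
mono-square {k} refl = ≋-trans (mono-⊗ (2 ℕ.^ k) (2 ℕ.^ k)) (≋-reflexive (cong mono (sym (2^suc k))))

σ-mono-double : ∀ k → σ (mono (k ℕ.+ k)) ≋ mono (k ℕ.+ k)
σ-mono-double zero    = ≋-refl
σ-mono-double (suc k) rewrite ℕ.+-suc k k =
  mulX-cong (mulX-cong (≋-trans (neg-cong (neg-cong (σ-mono-double k))) (neg-involutive (mono (k ℕ.+ k)))))

σ-mono-2^ : ∀ {e} → 1 ℕ.≤ e → σ (mono (2 ℕ.^ e)) ≋ mono (2 ℕ.^ e)
σ-mono-2^ {suc k} _ rewrite 2^suc k = σ-mono-double (2 ℕ.^ k)

σ-So : ∀ m → σ (So m) ≋ So m
σ-So zero    = ≋-refl
σ-So (suc m) = ≋-trans (σ-⊕ (So m) y) (⊕-cong (σ-So m) (σ-mono-2^ (ℕ.m≤n+m 1 (2 ℕ.* m))))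
  where y = mono (2 ℕ.^ (2 ℕ.* m ℕ.+ 1))

σ-Se : ∀ m → σ (Se (suc m)) ≋ Se (suc m) - two ⊗ X
σ-Se zero    = from-yes (σ (Se 1) ≋? Se 1 - two ⊗ X)
σ-Se (suc m) = begin
  σ (Se (suc m) ⊕ y)          ≈⟨ σ-⊕ (Se (suc m)) y ⟩
  σ (Se (suc m)) ⊕ σ y        ≈⟨ ⊕-cong (σ-Se m) (σ-mono-2^ {2 ℕ.* suc m} (s≤s z≤n)) ⟩
  (Se (suc m) - two ⊗ X) ⊕ y
    ≈⟨ solve 3 (λ s y x → (s :- con 2 :* x) :+ y := (s :+ y) :- con 2 :* x) ≋-refl (Se (suc m)) y X ⟩
  (Se (suc m) ⊕ y) - two ⊗ X  ∎
  where open ≋-Reasoning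
        y = mono (2 ℕ.^ (2 ℕ.* suc m))

S-split-even : ∀ m → S (2 ℕ.* m) ≋ Se m ⊕ So m
S-split-even zero    = ≋-refl
S-split-even (suc m) = begin
  S (2 ℕ.* suc m)                                ≈⟨ ≋-reflexive (cong S (ℕ.*-suc 2 m)) ⟩
  (S (2 ℕ.* m) ⊕ y) ⊕ mono (2 ℕ.^ suc (2 ℕ.* m))
    ≈⟨ ⊕-cong (⊕-congʳ y (S-split-even m)) (≋-reflexive (cong (λ k → mono (2 ℕ.^ k)) (ℕ.+-comm 1 (2 ℕ.* m)))) ⟩
  ((Se m ⊕ So m) ⊕ y) ⊕ y′
    ≈⟨ solve 4 (λ e o y y′ → ((e :+ o) :+ y) :+ y′ := (e :+ y) :+ (o :+ y′)) ≋-refl (Se m) (So m) y y′ ⟩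
  Se (suc m) ⊕ So (suc m)                        ∎
  where open ≋-Reasoning
        y = mono (2 ℕ.^ (2 ℕ.* m))
        y′ = mono (2 ℕ.^ (2 ℕ.* m ℕ.+ 1))

S-split-odd : ∀ m → S (2 ℕ.* m ℕ.+ 1) ≋ So m ⊕ Se (suc m)
S-split-odd m rewrite ℕ.+-comm (2 ℕ.* m) 1 = begin
  S (2 ℕ.* m) ⊕ y    ≈⟨ ⊕-congʳ y (S-split-even m) ⟩
  (Se m ⊕ So m) ⊕ y  ≈⟨ solve 3 (λ e o y → (e :+ o) :+ y := o :+ (e :+ y)) ≋-refl (Se m) (So m) y ⟩
  So m ⊕ Se (suc m)  ∎
  where open ≋-Reasoning
        y = mono (2 ℕ.^ (2 ℕ.* m))

crossSum : ℕ → Poly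
crossSum zero    = []
crossSum (suc k) = crossSum k ⊕ mono (2 ℕ.^ k) ⊗ S k

S-square : ∀ k → S k ⊗ S k ≋ S (suc k) - X ⊕ two ⊗ crossSum k
S-square zero    = from-yes (S 0 ⊗ S 0 ≋? S 1 - X ⊕ two ⊗ crossSum 0)
S-square (suc k) = begin
  (s ⊕ y) ⊗ (s ⊕ y)
    ≈⟨ solve 2 (λ s y → (s :+ y) :* (s :+ y) := s :* s :+ y :* y :+ con 2 :* (y :* s)) ≋-refl s y ⟩
  s ⊗ s ⊕ y ⊗ y ⊕ two ⊗ (y ⊗ s)
    ≈⟨ ⊕-congʳ (two ⊗ (y ⊗ s)) (⊕-cong (S-square k) (mono-square {k} refl)) ⟩
  (S (suc k) - X ⊕ two ⊗ c) ⊕ y′ ⊕ two ⊗ (y ⊗ s)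
    ≈⟨ solve 5 (λ s x c y′ ys → s :- x :+ con 2 :* c :+ y′ :+ con 2 :* ys := (s :+ y′) :- x :+ con 2 :* (c :+ ys))
               ≋-refl (S (suc k)) X c y′ (y ⊗ s) ⟩
  S (suc (suc k)) - X ⊕ two ⊗ crossSum (suc k)
    ∎
  where open ≋-Reasoning
        s = S k
        y = mono (2 ℕ.^ k)
        y′ = mono (2 ℕ.^ suc k)
        c = crossSum k

mono-nextPower : ∀ k {s} → S k ≋ s → mono (2 ℕ.^ k) ≋ nextPower X s (crossSum k)
mono-nextPower k {s} Sk≋s = begin
  y
    ≈⟨ solve 4 (λ t y x c → y := (t :+ y) :- x :+ con 2 :* c :- t :+ x :- con 2 :* c) ≋-refl (S k) y X c ⟩
  S (suc k) - X ⊕ two ⊗ c - S k ⊕ X - two ⊗ c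
    ≈⟨ ⊕-congʳ (neg (two ⊗ c)) (⊕-congʳ X (⊕-cong (≋-sym (S-square k)) (neg-cong Sk≋s))) ⟩
  S k ⊗ S k - s ⊕ X - two ⊗ c
    ≈⟨ ⊕-congʳ (neg (two ⊗ c)) (⊕-congʳ X (⊕-congʳ (neg s) (⊗-cong Sk≋s Sk≋s))) ⟩
  nextPower X s c
    ∎
  where open ≋-Reasoning
        y = mono (2 ℕ.^ k)
        c = crossSum k

reindex : ∀ {e e′ A} → e ≡ e′ →
  scaledConvergents (2 ℕ.^ e ℕ.∸ 2) ≋M A → scaledConvergents (2 ℕ.^ e′ ℕ.∸ 2) ≋M A
reindex refl h = h

suc[2m+1] : ∀ m → suc (2 ℕ.* m ℕ.+ 1) ≡ 2 ℕ.* suc m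
suc[2m+1] m = trans (cong suc (ℕ.+-comm (2 ℕ.* m) 1)) (sym (ℕ.*-suc 2 m))

suc≡+1 : ∀ k → suc k ≡ k ℕ.+ 1
suc≡+1 k = ℕ.+-comm 1 k

mutual
  ansatz-2^[2m+2] : ∀ m → scaledConvergents (2 ℕ.^ (2 ℕ.* suc m) ℕ.∸ 2) ≋M
                            ansatz false X (So m) (Se (suc m)) (mono (2 ℕ.^ (2 ℕ.* m ℕ.+ 1)))
  ansatz-2^[2m+2] zero    = from-yes (scaledConvergents 2 ≋M? ansatz false X (So 0) (Se 1) (mono 2))
  ansatz-2^[2m+2] (suc m) = reindex (suc[2m+1] (suc m))
    (≋M-trans (ansatz-step true {e = 2 ℕ.* suc m ℕ.+ 1} {u = Se (suc m)} {v = So (suc m)}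
                 (ℕ.m≤n+m 1 (2 ℕ.* suc m)) (ansatz-2^[2m+3] m) (σ-Se m) (σ-So (suc m))
                 (σ-mono-2^ {2 ℕ.* suc m} (s≤s z≤n)) (mono-nextPower (2 ℕ.* suc m) (S-split-even (suc m))))
              (ansatz-cong false (≋-refl {X}) (≋-refl {So (suc m)}) (≋-refl {Se (suc (suc m))})
                 (mono-square (suc≡+1 (2 ℕ.* suc m)))))

  ansatz-2^[2m+3] : ∀ m → scaledConvergents (2 ℕ.^ (2 ℕ.* suc m ℕ.+ 1) ℕ.∸ 2) ≋M
                            ansatz true X (Se (suc m)) (So (suc m)) (mono (2 ℕ.^ (2 ℕ.* suc m)))
  ansatz-2^[2m+3] m = reindex (suc≡+1 (2 ℕ.* suc m))
    (≋M-trans (ansatz-step false {e = 2 ℕ.* suc m} {u = So m} {v = Se (suc m)}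
                 (s≤s z≤n) (ansatz-2^[2m+2] m) (σ-So m) (σ-Se m)
                 (σ-mono-2^ (ℕ.m≤n+m 1 (2 ℕ.* m))) (mono-nextPower (2 ℕ.* m ℕ.+ 1) (S-split-odd m)))
              (ansatz-cong true (≋-refl {X}) (≋-refl {Se (suc m)}) (≋-refl {So (suc m)})
                 (mono-square (suc[2m+1] m))))

X-⊗ : ∀ p → X ⊗ p ≋ mulX p
X-⊗ p = ⊕-cong (·-zero p) (mulX-cong (⊗-identityˡ p))

X-⊗-cancel : ∀ {p q} → X ⊗ p ≋ X ⊗ q → p ≋ q
X-⊗-cancel {p} {q} h = coeffwise λ k → coeff-~ (≋-trans (≋-sym (X-⊗ p)) (≋-trans h (X-⊗ q))) (suc k)

X-⊗-divX : ∀ p → coeff p 0 ≡ + 0 → X ⊗ divX p ≋ p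
X-⊗-divX []      _ = ≋-trans (X-⊗ []) (≋-sym []≋0ₚ)
X-⊗-divX (c ∷ p) h = ≋-trans (X-⊗ p) (∷-cong (~-reflexive (sym h)) ≋-refl)

coeff₀-⊗ : ∀ p q → coeff (p ⊗ q) 0 ≡ coeff p 0 ℤ.* coeff q 0
coeff₀-⊗ []      q = refl
coeff₀-⊗ (c ∷ p) q = trans (coeff-⊕ (c · q) (mulX (p ⊗ q)) 0) (trans (ℤ.+-identityʳ _) (coeff-· c q 0))

coeff₀-S : ∀ k → coeff (S k) 0 ≡ + 0
coeff₀-S zero    = refl
coeff₀-S (suc k) = trans (coeff-⊕ (S k) (mono (2 ℕ.^ k)) 0) (cong₂ ℤ._+_ (coeff₀-S k) (coeff₀-mono (ℕ.m^n>0 2 k)))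
  where coeff₀-mono : ∀ {i} → 1 ℕ.≤ i → coeff (mono i) 0 ≡ + 0
        coeff₀-mono {suc i} _ = refl

X-⊗-divX-S² : ∀ k → X ⊗ divX (S k ⊗ S k) ≋ S k ⊗ S k
X-⊗-divX-S² k = X-⊗-divX (S k ⊗ S k) (trans (coeff₀-⊗ (S k) (S k)) (cong (ℤ._* coeff (S k) 0) (coeff₀-S k)))

module Readout {n k ε u v y} (C≋ : scaledConvergents n ≋M ansatz ε X u v y) (Sk≋ : S k ≋ u ⊕ v) where

  εX : Poly
  εX = if ε then two ⊗ X else 0ₚ

  P-next : P (suc n) ≋ 1ₚ ⊕ εX ⊕ two ⊗ u
  P-next = ≋11 C≋

  Q-next : Q (suc n) ≋ 1ₚ - X ⊕ two ⊗ y - S k ⊗ S k ⊕ two ⊗ (X ⊗ v)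
  Q-next = ≋-trans (≋12 C≋)
    (⊕-congʳ (two ⊗ (X ⊗ v)) (⊕-congˡ (1ₚ - X ⊕ two ⊗ y) (neg-cong (⊗-cong (≋-sym Sk≋) (≋-sym Sk≋)))))

  P-this : P n ≋ 1ₚ ⊕ divX (S k ⊗ S k) - two ⊗ v
  P-this = X-⊗-cancel (begin
    X ⊗ P n                                  ≈⟨ ≋21 C≋ ⟩
    X ⊕ (u ⊕ v) ⊗ (u ⊕ v) - two ⊗ (X ⊗ v)
      ≈⟨ ⊕-congʳ (neg (two ⊗ (X ⊗ v)))
                 (⊕-congˡ X (≋-trans (⊗-cong (≋-sym Sk≋) (≋-sym Sk≋)) (≋-sym (X-⊗-divX-S² k)))) ⟩
    X ⊕ X ⊗ D - two ⊗ (X ⊗ v)                ≈⟨ solve 3 (λ x d v → x :+ x :* d :- con 2 :* (x :* v)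
                                                                 := x :* (con 1 :+ d :- con 2 :* v)) ≋-refl X D v ⟩
    X ⊗ (1ₚ ⊕ D - two ⊗ v)                   ∎)
    where open ≋-Reasoning
          D = divX (S k ⊗ S k)

  Q-this : Q n ≋ 1ₚ ⊕ εX ⊕ two ⊗ S k
  Q-this = ≋-trans (X-⊗-cancel (≋22 C≋)) (⊕-congˡ (1ₚ ⊕ εX) (⊗-congˡ two (≋-sym Sk≋)))

module Readout-2^[2m+2] (m : ℕ) = Readout {2 ℕ.^ (2 ℕ.* suc m) ℕ.∸ 2} {2 ℕ.* m ℕ.+ 1} {false} {So m}
  {Se (suc m)} {mono (2 ℕ.^ (2 ℕ.* m ℕ.+ 1))} (ansatz-2^[2m+2] m) (S-split-odd m)

module Readout-2^[2m+3] (m : ℕ) = Readout {2 ℕ.^ (2 ℕ.* suc m ℕ.+ 1) ℕ.∸ 2} {2 ℕ.* suc m} {true} {Se (suc m)}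
  {So (suc m)} {mono (2 ℕ.^ (2 ℕ.* suc m))} (ansatz-2^[2m+3] m) (S-split-even (suc m))

≋⇒≡₄ : ∀ {p q} → p ≋ q → p ≡₄ q
≋⇒≡₄ h k = ∣⇒∣ᵤ (n∣a-b (coeff-~ h k))

by-computation : ∀ p q → {True (p ≋? q)} → p ≡₄ q
by-computation p q {h} = ≋⇒≡₄ (toWitness h)

two-⊗ : ∀ p → two ⊗ p ≋ (+ 2) · p
two-⊗ = const-⊗ (+ 2)

2^e∸1 : ∀ e → 1 ℕ.≤ e → 2 ℕ.^ e ℕ.∸ 1 ≡ suc (2 ℕ.^ e ℕ.∸ 2)
2^e∸1 e 1≤e = cong (ℕ._∸ 1) (sym (2^e∸2+2 1≤e))

2*suc∸1 : ∀ m → 2 ℕ.* suc m ℕ.∸ 1 ≡ 2 ℕ.* m ℕ.+ 1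
2*suc∸1 m = cong (ℕ._∸ 1) (sym (suc[2m+1] m))

P-4^m-1 : ∀ m → 1 ℕ.≤ m → P (2 ℕ.^ (2 ℕ.* m) ℕ.∸ 1) ≡₄ (const (+ 1) ⊕ (+ 2) · So (m ℕ.∸ 1))
P-4^m-1 (suc m) _ = ≋⇒≡₄ (begin
  P (2 ℕ.^ e ℕ.∸ 1)           ≈⟨ ≋-reflexive (cong P (2^e∸1 e (s≤s z≤n))) ⟩
  P (suc (2 ℕ.^ e ℕ.∸ 2))     ≈⟨ P-next ⟩
  1ₚ ⊕ 0ₚ ⊕ two ⊗ So m        ≈⟨ ⊕-cong (⊕-identityʳ 1ₚ) (two-⊗ (So m)) ⟩
  1ₚ ⊕ (+ 2) · So m           ∎)
  where open ≋-Reasoning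
        open Readout-2^[2m+2] m
        e = 2 ℕ.* suc m

P-2·4^m-1 : ∀ m → P (2 ℕ.^ (2 ℕ.* m ℕ.+ 1) ℕ.∸ 1) ≡₄ (const (+ 1) ⊕ ((+ 2) ℤ.* (+ 1 ℤ.- δ0 m)) · X ⊕ (+ 2) · Se m)
P-2·4^m-1 zero    = by-computation (P 1) (const (+ 1) ⊕ ((+ 2) ℤ.* (+ 1 ℤ.- δ0 0)) · X ⊕ (+ 2) · Se 0)
P-2·4^m-1 (suc m) = ≋⇒≡₄ (begin
  P (2 ℕ.^ e ℕ.∸ 1)                    ≈⟨ ≋-reflexive (cong P (2^e∸1 e (ℕ.m≤n+m 1 (2 ℕ.* suc m)))) ⟩
  P (suc (2 ℕ.^ e ℕ.∸ 2))              ≈⟨ P-next ⟩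
  1ₚ ⊕ two ⊗ X ⊕ two ⊗ Se (suc m)      ≈⟨ ⊕-cong (⊕-congˡ 1ₚ (two-⊗ X)) (two-⊗ (Se (suc m))) ⟩
  1ₚ ⊕ (+ 2) · X ⊕ (+ 2) · Se (suc m)  ∎)
  where open ≋-Reasoning
        open Readout-2^[2m+3] m
        e = 2 ℕ.* suc m ℕ.+ 1

P-4^m-2 : ∀ m → 1 ℕ.≤ m →
  P (2 ℕ.^ (2 ℕ.* m) ℕ.∸ 2) ≡₄ (const (+ 1) ⊕ divX (S (2 ℕ.* m ℕ.∸ 1) ⊗ S (2 ℕ.* m ℕ.∸ 1)) ⊖ (+ 2) · Se m)
P-4^m-2 (suc m) _ = ≋⇒≡₄ (begin
  P (2 ℕ.^ (2 ℕ.* suc m) ℕ.∸ 2)                 ≈⟨ P-this ⟩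
  1ₚ ⊕ divX (S k ⊗ S k) - two ⊗ Se (suc m)      ≈⟨ ⊕-congˡ (1ₚ ⊕ divX (S k ⊗ S k)) (neg-cong (two-⊗ (Se (suc m)))) ⟩
  1ₚ ⊕ divX (S k ⊗ S k) ⊖ (+ 2) · Se (suc m)    ≡⟨ cong (λ j → 1ₚ ⊕ divX (S j ⊗ S j) ⊖ (+ 2) · Se (suc m)) (2*suc∸1 m) ⟨
  1ₚ ⊕ divX (S k′ ⊗ S k′) ⊖ (+ 2) · Se (suc m)  ∎)
  where open ≋-Reasoning
        open Readout-2^[2m+2] m
        k = 2 ℕ.* m ℕ.+ 1
        k′ = 2 ℕ.* suc m ℕ.∸ 1

P-2·4^m-2 : ∀ m → P (2 ℕ.^ (2 ℕ.* m ℕ.+ 1) ℕ.∸ 2) ≡₄ (const (+ 1) ⊕ divX (S (2 ℕ.* m) ⊗ S (2 ℕ.* m)) ⊖ (+ 2) · So m)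
P-2·4^m-2 zero    = by-computation (P 0) (const (+ 1) ⊕ divX (S 0 ⊗ S 0) ⊖ (+ 2) · So 0)
P-2·4^m-2 (suc m) = ≋⇒≡₄ (≋-trans P-this (⊕-congˡ (1ₚ ⊕ divX (S k ⊗ S k)) (neg-cong (two-⊗ (So (suc m))))))
  where open Readout-2^[2m+3] m
        k = 2 ℕ.* suc m

Q-4^m-1 : ∀ m → 1 ℕ.≤ m →
  Q (2 ℕ.^ (2 ℕ.* m) ℕ.∸ 1) ≡₄ (const (+ 1) ⊖ X ⊕ (+ 2) · mono (2 ℕ.^ (2 ℕ.* m ℕ.∸ 1))
                                  ⊖ S (2 ℕ.* m ℕ.∸ 1) ⊗ S (2 ℕ.* m ℕ.∸ 1) ⊕ (+ 2) · (X ⊗ Se m))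
Q-4^m-1 (suc m) _ = ≋⇒≡₄ (begin
  Q (2 ℕ.^ e ℕ.∸ 1)                                          ≈⟨ ≋-reflexive (cong Q (2^e∸1 e (s≤s z≤n))) ⟩
  Q (suc (2 ℕ.^ e ℕ.∸ 2))                                    ≈⟨ Q-next ⟩
  1ₚ - X ⊕ two ⊗ mono (2 ℕ.^ k) - S k ⊗ S k ⊕ two ⊗ (X ⊗ Se (suc m))
    ≈⟨ ⊕-cong (⊕-congʳ (neg (S k ⊗ S k)) (⊕-congˡ (1ₚ - X) (two-⊗ (mono (2 ℕ.^ k))))) (two-⊗ (X ⊗ Se (suc m))) ⟩
  1ₚ - X ⊕ (+ 2) · mono (2 ℕ.^ k) - S k ⊗ S k ⊕ (+ 2) · (X ⊗ Se (suc m))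
    ≡⟨ cong (λ j → 1ₚ - X ⊕ (+ 2) · mono (2 ℕ.^ j) - S j ⊗ S j ⊕ (+ 2) · (X ⊗ Se (suc m))) (2*suc∸1 m) ⟨
  1ₚ - X ⊕ (+ 2) · mono (2 ℕ.^ k′) - S k′ ⊗ S k′ ⊕ (+ 2) · (X ⊗ Se (suc m)) ∎)
  where open ≋-Reasoning
        open Readout-2^[2m+2] m
        e = 2 ℕ.* suc m
        k = 2 ℕ.* m ℕ.+ 1
        k′ = 2 ℕ.* suc m ℕ.∸ 1

Q-2·4^m-1 : ∀ m → Q (2 ℕ.^ (2 ℕ.* m ℕ.+ 1) ℕ.∸ 1) ≡₄ (const (+ 1) ⊖ X ⊕ ((+ 2) ℤ.* (+ 1 ℤ.- δ0 m)) · mono (2 ℕ.^ (2 ℕ.* m))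
                                                      ⊖ S (2 ℕ.* m) ⊗ S (2 ℕ.* m) ⊕ (+ 2) · (X ⊗ So m))
Q-2·4^m-1 zero    =
  by-computation (Q 1) (const (+ 1) ⊖ X ⊕ ((+ 2) ℤ.* (+ 1 ℤ.- δ0 0)) · mono 1 ⊖ S 0 ⊗ S 0 ⊕ (+ 2) · (X ⊗ So 0))
Q-2·4^m-1 (suc m) = ≋⇒≡₄ (begin
  Q (2 ℕ.^ e ℕ.∸ 1)                                          ≈⟨ ≋-reflexive (cong Q (2^e∸1 e (ℕ.m≤n+m 1 (2 ℕ.* suc m)))) ⟩
  Q (suc (2 ℕ.^ e ℕ.∸ 2))                                    ≈⟨ Q-next ⟩
  1ₚ - X ⊕ two ⊗ mono (2 ℕ.^ k) - S k ⊗ S k ⊕ two ⊗ (X ⊗ So (suc m))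
    ≈⟨ ⊕-cong (⊕-congʳ (neg (S k ⊗ S k)) (⊕-congˡ (1ₚ - X) (two-⊗ (mono (2 ℕ.^ k))))) (two-⊗ (X ⊗ So (suc m))) ⟩
  1ₚ - X ⊕ (+ 2) · mono (2 ℕ.^ k) - S k ⊗ S k ⊕ (+ 2) · (X ⊗ So (suc m)) ∎)
  where open ≋-Reasoning
        open Readout-2^[2m+3] m
        e = 2 ℕ.* suc m ℕ.+ 1
        k = 2 ℕ.* suc m

Q-4^m-2 : ∀ m → 1 ℕ.≤ m → Q (2 ℕ.^ (2 ℕ.* m) ℕ.∸ 2) ≡₄ (const (+ 1) ⊕ (+ 2) · S (2 ℕ.* m ℕ.∸ 1))
Q-4^m-2 (suc m) _ = ≋⇒≡₄ (begin
  Q (2 ℕ.^ (2 ℕ.* suc m) ℕ.∸ 2)       ≈⟨ Q-this ⟩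
  1ₚ ⊕ 0ₚ ⊕ two ⊗ S k                 ≈⟨ ⊕-cong (⊕-identityʳ 1ₚ) (two-⊗ (S k)) ⟩
  1ₚ ⊕ (+ 2) · S k                    ≡⟨ cong (λ j → 1ₚ ⊕ (+ 2) · S j) (2*suc∸1 m) ⟨
  1ₚ ⊕ (+ 2) · S (2 ℕ.* suc m ℕ.∸ 1)  ∎)
  where open ≋-Reasoning
        open Readout-2^[2m+2] m
        k = 2 ℕ.* m ℕ.+ 1

Q-2·4^m-2 : ∀ m → Q (2 ℕ.^ (2 ℕ.* m ℕ.+ 1) ℕ.∸ 2) ≡₄ (const (+ 1) ⊕ ((+ 2) ℤ.* (+ 1 ℤ.- δ0 m)) · X ⊕ (+ 2) · S (2 ℕ.* m))
Q-2·4^m-2 zero    = by-computation (Q 0) (const (+ 1) ⊕ ((+ 2) ℤ.* (+ 1 ℤ.- δ0 0)) · X ⊕ (+ 2) · S 0)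
Q-2·4^m-2 (suc m) = ≋⇒≡₄ (≋-trans Q-this (⊕-cong (⊕-congˡ 1ₚ (two-⊗ X)) (two-⊗ (S (2 ℕ.* suc m)))))
  where open Readout-2^[2m+3] m

open import Data.Nat using (_∸_; _^_; _*_; _+_; _≤_)
open import Data.Integer using () renaming (_-_ to _-ℤ_; _*_ to _*ℤ_)

proposition3p2 :
      (∀ (m : ℕ) → 1 ≤ m →
        P (2 ^ (2 * m) ∸ 1) ≡₄ (const (+ 1) ⊕ (+ 2) · So (m ∸ 1)))
    × (∀ (m : ℕ) →
        P (2 ^ (2 * m + 1) ∸ 1) ≡₄ (const (+ 1) ⊕ ((+ 2) *ℤ (+ 1 -ℤ δ0 m)) · X ⊕ (+ 2) · Se m))
    × (∀ (m : ℕ) → 1 ≤ m →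
        P (2 ^ (2 * m) ∸ 2) ≡₄ (const (+ 1) ⊕ divX (S (2 * m ∸ 1) ⊗ S (2 * m ∸ 1)) ⊖ (+ 2) · Se m))
    × (∀ (m : ℕ) →
        P (2 ^ (2 * m + 1) ∸ 2) ≡₄ (const (+ 1) ⊕ divX (S (2 * m) ⊗ S (2 * m)) ⊖ (+ 2) · So m))
    × (∀ (m : ℕ) → 1 ≤ m →
        Q (2 ^ (2 * m) ∸ 1) ≡₄ (const (+ 1) ⊖ X ⊕ (+ 2) · mono (2 ^ (2 * m ∸ 1))
                                 ⊖ S (2 * m ∸ 1) ⊗ S (2 * m ∸ 1) ⊕ (+ 2) · (X ⊗ Se m)))
    × (∀ (m : ℕ) →
        Q (2 ^ (2 * m + 1) ∸ 1) ≡₄ (const (+ 1) ⊖ X ⊕ ((+ 2) *ℤ (+ 1 -ℤ δ0 m)) · mono (2 ^ (2 * m))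
                                     ⊖ S (2 * m) ⊗ S (2 * m) ⊕ (+ 2) · (X ⊗ So m)))
    × (∀ (m : ℕ) → 1 ≤ m →
        Q (2 ^ (2 * m) ∸ 2) ≡₄ (const (+ 1) ⊕ (+ 2) · S (2 * m ∸ 1)))
    × (∀ (m : ℕ) →
        Q (2 ^ (2 * m + 1) ∸ 2) ≡₄ (const (+ 1) ⊕ ((+ 2) *ℤ (+ 1 -ℤ δ0 m)) · X ⊕ (+ 2) · S (2 * m)))
proposition3p2 =
  P-4^m-1 , P-2·4^m-1 , P-4^m-2 , P-2·4^m-2 , Q-4^m-1 , Q-2·4^m-1 , Q-4^m-2 , Q-2·4^m-2
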